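{- Let $(a_n)_{n\ge 0}$ be a sequence of elements of a commutative algebra $R$ over the field $\mathbb{Q}(q)$ of rational functions in the indeterminate $q$, and let $(a_n^*)_{n\ge0}$ be its $q$-dual sequence, $$a_n^*=\sum_{i=0}^n{n \brack i}(-1)^i a_i\, q^{\binom{i}{2}}.$$ Then for all integers $k,l\ge 0$ the following three identities hold: $$\sum_{j=0}^l {l \brack j}\frac{(-1)^j a_{k+j+1}^*}{[k+j+1]_q}\,q^{\binom{j+1}{2}-l(k+j+1)}+\sum_{j=0}^k {k \brack j}\frac{(-1)^j a_{l+j+1}}{[l+j+1]_q}\,q^{\binom{j+1}{2}}=\frac{a_0}{[k+l+1]_q{k+l \brack k}},$$ $$\sum_{j=0}^l{l \brack j}(-1)^j a_{k+j}^*\,q^{\binom{j+1}{2}-l(k+j)}=\sum_{j=0}^k{k \brack j}(-1)^j a_{l+j}\,q^{\binom{j}{2}},$$ $$\sum_{j=0}^{l+1} {l+1 \brack j}(-1)^{j+1}[k+j+1]_q\, a_{k+j}^*\, q^{\binom{j}{2}-l(k+j)-k}=\sum_{j=0}^{k+1} {k+1 \brack j}(-1)^j[l+j+1]_q\, a_{l+j}\,q^{\binom{j-1}{2}}.$$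
   Context: For an integer $k$, $[k]_q=\frac{1-q^k}{1-q}$. For an integer $\alpha$ and integer $k$, the $q$-binomial coefficient is ${\alpha \brack k}=0$ if $k<0$, ${\alpha\brack 0}=1$, and ${\alpha \brack k}=\frac{(1-q^{\alpha})(1-q^{\alpha-1})\cdots(1-q^{\alpha-k+1})}{(1-q)(1-q^2)\cdots(1-q^k)}$ for $k\ge 1$ (so ${n\brack k}=0$ for integers $0\le n<k$). For every integer $m$ (including negative $m$), $\binom{m}{2}=m(m-1)/2$; e.g. $\binom{ -1}{2}=1$. -}

module Defs where

open import Level using (Level; _⊔_) renaming (suc to lsuc)
open import Data.Nat using (ℕ; zero; suc; _∸_) renaming (_+_ to _+ℕ_)
open import Data.Integer using (ℤ; +_; -[1+_]) renaming (_+_ to _+ℤ_; _*_ to _*ℤ_)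
open import Data.List using (List; []; _∷_; _∷ʳ_; replicate; map)
open import Data.List.Relation.Unary.Any using (Any; here; there)
open import Data.Product using (Σ; _,_)
open import Relation.Binary.PropositionalEquality using (_≡_; refl)
open import Relation.Nullary using (¬_)
open import Algebra.Bundles using (CommutativeRing)

-- Polynomials with integer coefficients (coefficient lists, constant
-- term first).  Q(q) = Frac(ℤ[q]).

Poly : Set
Poly = List ℤ

_+P_ : Poly → Poly → Poly
[] +P p = p
(a ∷ p) +P [] = a ∷ p
(a ∷ p) +P (b ∷ r) = (a +ℤ b) ∷ (p +P r)

scaleP : ℤ → Poly → Poly
scaleP a p = map (a *ℤ_) p

_*P_ : Poly → Poly → Poly
[] *P r = []
(a ∷ p) *P r = scaleP a r +P (+ 0 ∷ (p *P r))

NonZeroPoly : Poly → Set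
NonZeroPoly p = Any (λ c → ¬ (c ≡ + 0)) p

oneMinusX^ : ℕ → Poly
oneMinusX^ zero = []
oneMinusX^ (suc n) = + 1 ∷ (replicate n (+ 0) ∷ʳ -[1+ 0 ])

polyX : Poly
polyX = + 0 ∷ + 1 ∷ []

-- numerator of the q-binomial [α brack k]:  (1-x^α)(1-x^(α-1))...(1-x^(α-k+1))
numP : ℕ → ℕ → Poly
numP α zero = + 1 ∷ []
numP α (suc k) = oneMinusX^ α *P numP (α ∸ 1) k

-- denominator of the q-binomial:  (1-x)(1-x^2)...(1-x^k)
denP : ℕ → Poly
denP zero = + 1 ∷ []
denP (suc k) = denP k *P oneMinusX^ (suc k)

HeadOne : Poly → Set
HeadOne p = Σ Poly (λ t → p ≡ (+ 1 ∷ t))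

headOne-nz : ∀ p → HeadOne p → NonZeroPoly p
headOne-nz .(+ 1 ∷ t) (t , refl) = here (λ ())

headOne-* : ∀ p r → HeadOne p → HeadOne r → HeadOne (p *P r)
headOne-* .(+ 1 ∷ t) .(+ 1 ∷ u) (t , refl) (u , refl) = _ , refl

headOne-omx : ∀ n → HeadOne (oneMinusX^ (suc n))
headOne-omx n = _ , refl

headOne-den : ∀ k → HeadOne (denP k)
headOne-den zero = _ , refl
headOne-den (suc k) = headOne-* (denP k) (oneMinusX^ (suc k)) (headOne-den k) (headOne-omx k)

headOne-num : ∀ k l → HeadOne (numP (k +ℕ l) k)
headOne-num zero l = _ , refl
headOne-num (suc k) l =
  headOne-* (oneMinusX^ (suc (k +ℕ l))) (numP (k +ℕ l) k) (headOne-omx (k +ℕ l)) (headOne-num k l)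

x-nz : NonZeroPoly polyX
x-nz = there (here (λ ()))

module Eval {c ℓ : Level} (R : CommutativeRing c ℓ) where
  open CommutativeRing R

  natR : ℕ → Carrier
  natR zero = 0#
  natR (suc n) = 1# + natR n

  intR : ℤ → Carrier
  intR (+ n) = natR n
  intR -[1+ n ] = - natR (suc n)

  evalP : Carrier → Poly → Carrier
  evalP x [] = 0#
  evalP x (a ∷ p) = intR a + x * evalP x p

  pow : Carrier → ℕ → Carrier
  pow x zero = 1#
  pow x (suc n) = x * pow x n

-- A commutative algebra over Q(q): a commutative ring R with an element
-- q (the image of the indeterminate) such that every nonzero p ∈ ℤ[x]
-- becomes invertible at q.  By the universal property of the fraction
-- field Q(q) = Frac(ℤ[q]) this is exactly a ring map Q(q) → R.

record QqAlgebra (c ℓ : Level) : Set (lsuc (c ⊔ ℓ)) where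
  field
    base : CommutativeRing c ℓ
  open CommutativeRing base using (Carrier; _≈_; _*_; 1#)
  open Eval base using (evalP)
  field
    q : Carrier
    inv : (p : Poly) → NonZeroPoly p → Carrier
    inv-correct : ∀ p (nz : NonZeroPoly p) → (evalP q p * inv p nz) ≈ 1#

-- binomial(m,2) = m(m-1)/2 for an integer m (always a natural number)
choose2ℕ : ℕ → ℕ
choose2ℕ zero = 0
choose2ℕ (suc n) = choose2ℕ n +ℕ n

choose2 : ℤ → ℕ
choose2 (+ n) = choose2ℕ n
choose2 -[1+ n ] = choose2ℕ (suc (suc n))   -- (-(n+1))(-(n+2))/2

module Ops {c ℓ : Level} (A : QqAlgebra c ℓ) where
  open QqAlgebra A public
  open CommutativeRing base public
  open Eval base public

  q⁻¹ : Carrier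
  q⁻¹ = inv polyX x-nz

  qpow : ℤ → Carrier
  qpow (+ n) = pow q n
  qpow -[1+ n ] = pow q⁻¹ (suc n)

  sgn : ℕ → Carrier
  sgn j = pow (- 1#) j

  qint : ℕ → Carrier
  qint n = evalP q (oneMinusX^ n) * inv (oneMinusX^ 1) (headOne-nz _ (headOne-omx 0))

  -- 1/[n+1]_q = (1-q)/(1-q^(n+1))
  invQint : ℕ → Carrier
  invQint n = evalP q (oneMinusX^ 1) * inv (oneMinusX^ (suc n)) (headOne-nz _ (headOne-omx n))

  gbin : ℕ → ℕ → Carrier
  gbin α zero = 1#
  gbin α (suc k) = evalP q (numP α (suc k)) * inv (denP (suc k)) (headOne-nz _ (headOne-den (suc k)))

  -- 1 / [k+l brack k]
  invGbin : ℕ → ℕ → Carrier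
  invGbin zero l = 1#
  invGbin (suc k) l = evalP q (denP (suc k)) * inv (numP (suc k +ℕ l) (suc k)) (headOne-nz _ (headOne-num (suc k) l))

  sumTo : ℕ → (ℕ → Carrier) → Carrier
  sumTo zero f = f 0
  sumTo (suc n) f = sumTo n f + f (suc n)

  dual : (ℕ → Carrier) → ℕ → Carrier
  dual a n = sumTo n (λ i → gbin n i * sgn i * a i * qpow (+ choose2 (+ i)))

-- Write qdiff e k l for the left-hand side of the second identity with a* replaced by an
-- arbitrary sequence e. By the q-Pascal rule it is an iterated q-difference,
-- q^k qdiff e k (l+1) = qdiff e k l - qdiff e (k+1) l, and the q-dual obeys the matching
-- recursion a*_{n+1} = a*_n - q^n (a_{·+1})*_n, so the second identity follows by induction on l.
-- Splitting [m]_q = (1 - q^m)/(1 - q) turns both sides of the third identity into instances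
-- of the second. For the first, q-absorption [n+1, i+1]/[n+1] = [n, i]/[i+1] gives
-- a*_{n+1}/[n+1] = a_0/[n+1] - c*_n with c_i = q^i a_{i+1}/[i+1]; by the second identity the
-- c-part cancels the second sum, and what remains is a_0 times the iterated q-difference of
-- m ↦ 1/[m], which equals 1/([k+l+1] [k+l, k]) because both satisfy the same recursion in l.

{-# OPTIONS --safe #-}
module Submission where

open import Defs
open import Level using (Level)
open import Data.Nat using (ℕ; zero; suc; _∸_; _≤_; z≤n) renaming (_+_ to _+ℕ_; _*_ to _*ℕ_)
import Data.Nat.Properties as ℕP
open import Data.Integer as ℤ using (ℤ; +_; -[1+_]; _⊖_) renaming (_+_ to _+ℤ_; _*_ to _*ℤ_; -_ to -ℤ_; _-_ to _-ℤ_)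
import Data.Integer.Properties as ℤP
open import Data.Integer.Tactic.RingSolver using (solve-∀)
open import Data.Nat.Tactic.RingSolver using () renaming (solve-∀ to solve-∀ℕ)
open import Data.List using ([]; _∷_; _∷ʳ_; replicate)
open import Data.Maybe using (Maybe; just; nothing)
open import Data.Product using (Σ; _,_; _×_)
open import Relation.Nullary using (yes; no)
open import Relation.Binary.PropositionalEquality as ≡ using (_≡_)
open import Algebra.Bundles using (CommutativeRing)
import Algebra.Solver.Ring
open import Algebra.Solver.Ring.AlmostCommutativeRing using (_-Raw-AlmostCommutative⟶_; fromCommutativeRing)

module Evaluation {c ℓ : Level} (R : CommutativeRing c ℓ) where
  open CommutativeRing R
  open Eval R
  open import Algebra.Properties.Ring ring using (-‿+-comm; -0#≈0#; -‿involutive; -‿distribˡ-*; -‿distribʳ-*)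
  open import Algebra.Properties.Semiring.Mult semiring using (×-homo-+; ×1-homo-*) renaming (_×_ to _·_)
  open import Algebra.Properties.Semiring.Exp semiring using (_^_; ^-homo-*)
  open import Relation.Binary.Reasoning.Setoid setoid

  natR≈×1# : ∀ n → natR n ≈ n · 1#
  natR≈×1# zero = refl
  natR≈×1# (suc n) = +-congˡ (natR≈×1# n)

  natR-+ : ∀ m n → natR (m +ℕ n) ≈ natR m + natR n
  natR-+ m n = begin
    natR (m +ℕ n)           ≈⟨ natR≈×1# (m +ℕ n) ⟩
    (m +ℕ n) · 1#           ≈⟨ ×-homo-+ 1# m n ⟩
    m · 1# + n · 1#         ≈⟨ +-cong (natR≈×1# m) (natR≈×1# n) ⟨
    natR m + natR n         ∎

  natR-* : ∀ m n → natR (m *ℕ n) ≈ natR m * natR n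
  natR-* m n = begin
    natR (m *ℕ n)           ≈⟨ natR≈×1# (m *ℕ n) ⟩
    (m *ℕ n) · 1#           ≈⟨ ×1-homo-* m n ⟩
    (m · 1#) * (n · 1#)     ≈⟨ *-cong (natR≈×1# m) (natR≈×1# n) ⟨
    natR m * natR n         ∎

  intR-⊖ : ∀ m n → intR (m ⊖ n) ≈ natR m - natR n
  intR-⊖ m       zero    = sym (trans (+-congˡ -0#≈0#) (+-identityʳ _))
  intR-⊖ zero    (suc n) = sym (+-identityˡ _)
  intR-⊖ (suc m) (suc n) = begin
    intR (suc m ⊖ suc n)            ≡⟨ ≡.cong intR (ℤP.[1+m]⊖[1+n]≡m⊖n m n) ⟩
    intR (m ⊖ n)                    ≈⟨ intR-⊖ m n ⟩
    natR m - natR n                 ≈⟨ +-identityˡ _ ⟨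
    0# + (natR m - natR n)          ≈⟨ +-congʳ (-‿inverseʳ 1#) ⟨
    (1# - 1#) + (natR m - natR n)   ≈⟨ +-assoc 1# (- 1#) _ ⟩
    1# + (- 1# + (natR m - natR n)) ≈⟨ +-congˡ (+-comm (- 1#) _) ⟩
    1# + ((natR m - natR n) - 1#)   ≈⟨ +-congˡ (+-assoc (natR m) _ _) ⟩
    1# + (natR m + (- natR n - 1#)) ≈⟨ +-assoc 1# (natR m) _ ⟨
    (1# + natR m) + (- natR n - 1#) ≈⟨ +-congˡ (trans (+-comm _ _) (-‿+-comm 1# (natR n))) ⟩
    natR (suc m) - natR (suc n)     ∎

  intR-+ : ∀ i j → intR (i +ℤ j) ≈ intR i + intR j
  intR-+ (+ m)    (+ n)    = natR-+ m n
  intR-+ (+ m)    -[1+ n ] = intR-⊖ m (suc n)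
  intR-+ -[1+ m ] (+ n)    = trans (intR-⊖ n (suc m)) (+-comm _ _)
  intR-+ -[1+ m ] -[1+ n ] = begin
    - natR (suc (suc (m +ℕ n)))     ≡⟨ ≡.cong (λ k → - natR k) (ℕP.+-suc (suc m) n) ⟨
    - natR (suc m +ℕ suc n)         ≈⟨ -‿cong (natR-+ (suc m) (suc n)) ⟩
    - (natR (suc m) + natR (suc n)) ≈⟨ -‿+-comm _ _ ⟨
    - natR (suc m) - natR (suc n)   ∎

  intR-neg : ∀ i → intR (-ℤ i) ≈ - intR i
  intR-neg (+ zero)  = sym -0#≈0#
  intR-neg (+ suc n) = refl
  intR-neg -[1+ n ]  = sym (-‿involutive _)

  intR-pos-* : ∀ m j → intR (+ m *ℤ j) ≈ natR m * intR j
  intR-pos-* m (+ n) = begin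
    intR (+ m *ℤ + n)    ≡⟨ ≡.cong intR (ℤP.pos-* m n) ⟨
    natR (m *ℕ n)        ≈⟨ natR-* m n ⟩
    natR m * natR n      ∎
  intR-pos-* m -[1+ n ] = begin
    intR (+ m *ℤ -[1+ n ])         ≡⟨ ≡.cong intR (ℤP.neg-distribʳ-* (+ m) (+ suc n)) ⟨
    intR (-ℤ (+ m *ℤ + suc n))     ≈⟨ intR-neg (+ m *ℤ + suc n) ⟩
    - intR (+ m *ℤ + suc n)        ≈⟨ -‿cong (intR-pos-* m (+ suc n)) ⟩
    - (natR m * natR (suc n))      ≈⟨ -‿distribʳ-* (natR m) _ ⟩
    natR m * - natR (suc n)        ∎

  intR-* : ∀ i j → intR (i *ℤ j) ≈ intR i * intR j
  intR-* (+ m)    j = intR-pos-* m j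
  intR-* -[1+ m ] j = begin
    intR (-[1+ m ] *ℤ j)           ≡⟨ ≡.cong intR (ℤP.neg-distribˡ-* (+ suc m) j) ⟨
    intR (-ℤ (+ suc m *ℤ j))       ≈⟨ intR-neg (+ suc m *ℤ j) ⟩
    - intR (+ suc m *ℤ j)          ≈⟨ -‿cong (intR-pos-* (suc m) j) ⟩
    - (natR (suc m) * intR j)      ≈⟨ -‿distribˡ-* _ (intR j) ⟩
    - natR (suc m) * intR j        ∎

  -- Agrees with intR, but sends 0, 1 and -1 to 0#, 1# and - 1# on the nose,
  -- so that constants in solver equations are the intended ring elements.
  coeff : ℤ → Carrier
  coeff (+ zero)          = 0#
  coeff (+ suc zero)      = 1#
  coeff (+ suc (suc n))   = intR (+ suc (suc n))
  coeff -[1+ zero ]       = - 1#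
  coeff -[1+ suc n ]      = intR -[1+ suc n ]

  coeff≈intR : ∀ i → coeff i ≈ intR i
  coeff≈intR (+ zero)        = refl
  coeff≈intR (+ suc zero)    = sym (+-identityʳ 1#)
  coeff≈intR (+ suc (suc n)) = refl
  coeff≈intR -[1+ zero ]     = -‿cong (sym (+-identityʳ 1#))
  coeff≈intR -[1+ suc n ]    = refl

  coeff-morphism : ℤ.+-*-rawRing -Raw-AlmostCommutative⟶ fromCommutativeRing R
  coeff-morphism = record
    { ⟦_⟧    = coeff
    ; +-homo = λ i j → via-intR (i +ℤ j) (intR-+ i j) (+-cong (coeff≈intR i) (coeff≈intR j))
    ; *-homo = λ i j → via-intR (i *ℤ j) (intR-* i j) (*-cong (coeff≈intR i) (coeff≈intR j))
    ; -‿homo = λ i → via-intR (-ℤ i) (intR-neg i) (-‿cong (coeff≈intR i))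
    ; 0-homo = refl
    ; 1-homo = refl
    }
    where
    via-intR : ∀ i {y z} → intR i ≈ y → z ≈ y → coeff i ≈ z
    via-intR i p q = trans (coeff≈intR i) (trans p (sym q))

  coeff-≟ : ∀ i j → Maybe (coeff i ≈ coeff j)
  coeff-≟ i j with i ℤ.≟ j
  ... | yes ≡.refl = just refl
  ... | no _       = nothing

  open Algebra.Solver.Ring ℤ.+-*-rawRing (fromCommutativeRing R) coeff-morphism coeff-≟ public
    using (solve; _:=_; _:+_; _:*_; :-_; _:-_; con)

  *-assoc₃ : ∀ a b c d → a * b * c * d ≈ a * (b * c * d)
  *-assoc₃ = solve 4 (λ a b c d → a :* b :* c :* d := a :* (b :* c :* d)) refl

  pow≈^ : ∀ x n → pow x n ≈ x ^ n
  pow≈^ x zero    = refl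
  pow≈^ x (suc n) = *-congˡ (pow≈^ x n)

  pow-+ : ∀ x m n → pow x (m +ℕ n) ≈ pow x m * pow x n
  pow-+ x m n = begin
    pow x (m +ℕ n)        ≈⟨ pow≈^ x (m +ℕ n) ⟩
    x ^ (m +ℕ n)          ≈⟨ ^-homo-* x m n ⟩
    x ^ m * x ^ n         ≈⟨ *-cong (pow≈^ x m) (pow≈^ x n) ⟨
    pow x m * pow x n     ∎

  evalP-+ : ∀ x p r → evalP x (p +P r) ≈ evalP x p + evalP x r
  evalP-+ x []      r       = sym (+-identityˡ _)
  evalP-+ x (a ∷ p) []      = sym (+-identityʳ _)
  evalP-+ x (a ∷ p) (b ∷ r) = begin
    intR (a +ℤ b) + x * evalP x (p +P r)            ≈⟨ +-cong (intR-+ a b) (*-congˡ (evalP-+ x p r)) ⟩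
    (intR a + intR b) + x * (evalP x p + evalP x r) ≈⟨ solve 5 (λ a b x p r → (a :+ b) :+ x :* (p :+ r) := (a :+ x :* p) :+ (b :+ x :* r))
                                                          refl (intR a) (intR b) x (evalP x p) (evalP x r) ⟩
    (intR a + x * evalP x p) + (intR b + x * evalP x r) ∎

  evalP-scaleP : ∀ x a p → evalP x (scaleP a p) ≈ intR a * evalP x p
  evalP-scaleP x a []      = sym (zeroʳ _)
  evalP-scaleP x a (b ∷ p) = begin
    intR (a *ℤ b) + x * evalP x (scaleP a p)   ≈⟨ +-cong (intR-* a b) (*-congˡ (evalP-scaleP x a p)) ⟩
    intR a * intR b + x * (intR a * evalP x p) ≈⟨ solve 4 (λ a b x p → a :* b :+ x :* (a :* p) := a :* (b :+ x :* p))
                                                     refl (intR a) (intR b) x (evalP x p) ⟩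
    intR a * (intR b + x * evalP x p)          ∎

  evalP-* : ∀ x p r → evalP x (p *P r) ≈ evalP x p * evalP x r
  evalP-* x []      r = sym (zeroˡ _)
  evalP-* x (a ∷ p) r = begin
    evalP x (scaleP a r +P (+ 0 ∷ (p *P r)))                  ≈⟨ evalP-+ x (scaleP a r) _ ⟩
    evalP x (scaleP a r) + (0# + x * evalP x (p *P r))         ≈⟨ +-cong (evalP-scaleP x a r) (+-congˡ (*-congˡ (evalP-* x p r))) ⟩
    intR a * evalP x r + (0# + x * (evalP x p * evalP x r))    ≈⟨ solve 4 (λ a r x p → a :* r :+ (con (+ 0) :+ x :* (p :* r)) := (a :+ x :* p) :* r)
                                                                    refl (intR a) (evalP x r) x (evalP x p) ⟩
    (intR a + x * evalP x p) * evalP x r                       ∎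

  evalP-monomial : ∀ x n a → evalP x (replicate n (+ 0) ∷ʳ a) ≈ pow x n * intR a
  evalP-monomial x zero    a = solve 2 (λ a x → a :+ x :* con (+ 0) := con (+ 1) :* a) refl (intR a) x
  evalP-monomial x (suc n) a = begin
    0# + x * evalP x (replicate n (+ 0) ∷ʳ a) ≈⟨ +-congˡ (*-congˡ (evalP-monomial x n a)) ⟩
    0# + x * (pow x n * intR a)               ≈⟨ solve 3 (λ x p a → con (+ 0) :+ x :* (p :* a) := (x :* p) :* a) refl x (pow x n) (intR a) ⟩
    (x * pow x n) * intR a                    ∎

  evalP-oneMinusX^ : ∀ x n → evalP x (oneMinusX^ n) ≈ 1# - pow x n
  evalP-oneMinusX^ x zero    = sym (-‿inverseʳ 1#)
  evalP-oneMinusX^ x (suc n) = begin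
    intR (+ 1) + x * evalP x (replicate n (+ 0) ∷ʳ -[1+ 0 ]) ≈⟨ +-congˡ (*-congˡ (evalP-monomial x n -[1+ 0 ])) ⟩
    intR (+ 1) + x * (pow x n * intR -[1+ 0 ])               ≈⟨ +-cong (coeff≈intR (+ 1)) (*-congˡ (*-congˡ (coeff≈intR -[1+ 0 ]))) ⟨
    1# + x * (pow x n * - 1#)                                ≈⟨ solve 2 (λ x p → con (+ 1) :+ x :* (p :* :- con (+ 1)) := con (+ 1) :- x :* p) refl x (pow x n) ⟩
    1# - x * pow x n                                         ∎

  evalP-polyX : ∀ x → evalP x polyX ≈ x
  evalP-polyX x = begin
    intR (+ 0) + x * (intR (+ 1) + x * 0#) ≈⟨ +-congˡ (*-congˡ (+-congʳ (coeff≈intR (+ 1)))) ⟨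
    0# + x * (1# + x * 0#)                 ≈⟨ solve 1 (λ x → con (+ 0) :+ x :* (con (+ 1) :+ x :* con (+ 0)) := x) refl x ⟩
    x                                      ∎

module QIdentities {c ℓ : Level} (A : QqAlgebra c ℓ) where
  open Ops A
  open Evaluation base
  open import Algebra.Properties.Ring ring using (-‿+-comm; [y-z]x≈yx-zx)
  open import Relation.Binary.Reasoning.Setoid setoid

  Invertible : Carrier → Set _
  Invertible x = Σ Carrier λ y → x * y ≈ 1#

  *-invertible : ∀ {x y} → Invertible x → Invertible y → Invertible (x * y)
  *-invertible {x} {y} (x′ , xx′≈1) (y′ , yy′≈1) = x′ * y′ , (begin
    (x * y) * (x′ * y′) ≈⟨ solve 4 (λ x y x′ y′ → (x :* y) :* (x′ :* y′) := (x :* x′) :* (y :* y′)) refl x y x′ y′ ⟩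
    (x * x′) * (y * y′) ≈⟨ *-cong xx′≈1 yy′≈1 ⟩
    1# * 1#             ≈⟨ *-identityˡ 1# ⟩
    1#                  ∎)

  pow-invertible : ∀ {x} → Invertible x → ∀ n → Invertible (pow x n)
  pow-invertible x⁻¹ zero    = 1# , *-identityˡ 1#
  pow-invertible x⁻¹ (suc n) = *-invertible x⁻¹ (pow-invertible x⁻¹ n)

  *-cancelʳ-invertible : ∀ {m x y} → Invertible m → x * m ≈ y * m → x ≈ y
  *-cancelʳ-invertible {m} {x} {y} (m′ , mm′≈1) xm≈ym = begin
    x            ≈⟨ *-identityʳ x ⟨
    x * 1#       ≈⟨ *-congˡ mm′≈1 ⟨
    x * (m * m′) ≈⟨ *-assoc x m m′ ⟨
    (x * m) * m′ ≈⟨ *-congʳ xm≈ym ⟩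
    (y * m) * m′ ≈⟨ *-assoc y m m′ ⟩
    y * (m * m′) ≈⟨ *-congˡ mm′≈1 ⟩
    y * 1#       ≈⟨ *-identityʳ y ⟩
    y            ∎

  q*q⁻¹≈1# : q * q⁻¹ ≈ 1#
  q*q⁻¹≈1# = trans (*-congʳ (sym (evalP-polyX q))) (inv-correct polyX x-nz)

  q-invertible : Invertible q
  q-invertible = q⁻¹ , q*q⁻¹≈1#

  inv-cancelʳ : ∀ x p (nz : NonZeroPoly p) → x * inv p nz * evalP q p ≈ x
  inv-cancelʳ x p nz = begin
    x * inv p nz * evalP q p   ≈⟨ *-assoc x _ _ ⟩
    x * (inv p nz * evalP q p) ≈⟨ *-congˡ (trans (*-comm _ _) (inv-correct p nz)) ⟩
    x * 1#                     ≈⟨ *-identityʳ x ⟩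
    x                          ∎

  -- q-binomial coefficients

  oneMinusQ^ : ℕ → Carrier
  oneMinusQ^ n = evalP q (oneMinusX^ n)

  num : ℕ → ℕ → Carrier
  num α k = evalP q (numP α k)

  den : ℕ → Carrier
  den k = evalP q (denP k)

  oneMinusQ^-invertible : ∀ n → Invertible (oneMinusQ^ (suc n))
  oneMinusQ^-invertible n = _ , inv-correct _ (headOne-nz _ (headOne-omx n))

  den-invertible : ∀ k → Invertible (den k)
  den-invertible k = _ , inv-correct _ (headOne-nz _ (headOne-den k))

  num-invertible : ∀ k l → Invertible (num (k +ℕ l) k)
  num-invertible k l = _ , inv-correct _ (headOne-nz _ (headOne-num k l))

  oneMinusQ^≈ : ∀ n → oneMinusQ^ n ≈ 1# - pow q n
  oneMinusQ^≈ = evalP-oneMinusX^ q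

  num-zero : ∀ α → num α 0 ≈ 1#
  num-zero α = trans (+-cong (+-identityʳ 1#) (zeroʳ q)) (+-identityʳ 1#)

  num-suc : ∀ α k → num α (suc k) ≈ oneMinusQ^ α * num (α ∸ 1) k
  num-suc α k = evalP-* q (oneMinusX^ α) (numP (α ∸ 1) k)

  den-suc : ∀ k → den (suc k) ≈ den k * oneMinusQ^ (suc k)
  den-suc k = evalP-* q (denP k) (oneMinusX^ (suc k))

  num-sucʳ : ∀ α k → num α (suc k) ≈ num α k * oneMinusQ^ (α ∸ k)
  num-sucʳ α zero = begin
    num α 1                      ≈⟨ num-suc α 0 ⟩
    oneMinusQ^ α * num (α ∸ 1) 0 ≈⟨ *-congˡ (num-zero (α ∸ 1)) ⟩
    oneMinusQ^ α * 1#            ≈⟨ *-comm _ _ ⟩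
    1# * oneMinusQ^ α            ≈⟨ *-congʳ (num-zero α) ⟨
    num α 0 * oneMinusQ^ α       ∎
  num-sucʳ α (suc k) = begin
    num α (suc (suc k))                                     ≈⟨ num-suc α (suc k) ⟩
    oneMinusQ^ α * num (α ∸ 1) (suc k)                      ≈⟨ *-congˡ (num-sucʳ (α ∸ 1) k) ⟩
    oneMinusQ^ α * (num (α ∸ 1) k * oneMinusQ^ (α ∸ 1 ∸ k)) ≈⟨ *-assoc _ _ _ ⟨
    oneMinusQ^ α * num (α ∸ 1) k * oneMinusQ^ (α ∸ 1 ∸ k)   ≈⟨ *-cong (sym (num-suc α k)) (reflexive (≡.cong oneMinusQ^ (ℕP.∸-+-assoc α 1 k))) ⟩
    num α (suc k) * oneMinusQ^ (α ∸ suc k)                  ∎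

  num-vanishes : ∀ n → num n (suc n) ≈ 0#
  num-vanishes zero    = trans (num-suc 0 0) (zeroˡ _)
  num-vanishes (suc n) = trans (num-suc (suc n) (suc n)) (trans (*-congˡ (num-vanishes n)) (zeroʳ _))

  num-self : ∀ n → num n n ≈ den n
  num-self zero    = refl
  num-self (suc n) = begin
    num (suc n) (suc n)            ≈⟨ num-suc (suc n) n ⟩
    oneMinusQ^ (suc n) * num n n   ≈⟨ *-congˡ (num-self n) ⟩
    oneMinusQ^ (suc n) * den n     ≈⟨ *-comm _ _ ⟩
    den n * oneMinusQ^ (suc n)     ≈⟨ den-suc n ⟨
    den (suc n)                    ∎

  gbin*den : ∀ α k → gbin α k * den k ≈ num α k
  gbin*den α zero    = *-identityˡ _
  gbin*den α (suc k) = inv-cancelʳ (num α (suc k)) (denP (suc k)) _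

  gbin-vanishes : ∀ n → gbin n (suc n) ≈ 0#
  gbin-vanishes n = *-cancelʳ-invertible (den-invertible (suc n))
    (trans (gbin*den n (suc n)) (trans (num-vanishes n) (sym (zeroˡ _))))

  gbin-suc*den : ∀ n j → gbin n (suc j) * den (suc j) ≈ num n j * (1# - pow q (n ∸ j))
  gbin-suc*den n j = trans (gbin*den n (suc j)) (trans (num-sucʳ n j) (*-congˡ (oneMinusQ^≈ (n ∸ j))))

  gbin*den-suc : ∀ n j → gbin n j * den (suc j) ≈ num n j * (1# - pow q (suc j))
  gbin*den-suc n j = begin
    gbin n j * den (suc j)                     ≈⟨ *-congˡ (den-suc j) ⟩
    gbin n j * (den j * oneMinusQ^ (suc j))    ≈⟨ *-assoc _ _ _ ⟨
    gbin n j * den j * oneMinusQ^ (suc j)      ≈⟨ *-cong (gbin*den n j) (oneMinusQ^≈ (suc j)) ⟩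
    num n j * (1# - pow q (suc j))             ∎

  gbin-suc-suc*den : ∀ {n j} → j ≤ n → gbin (suc n) (suc j) * den (suc j) ≈ num n j * (1# - pow q (suc j) * pow q (n ∸ j))
  gbin-suc-suc*den {n} {j} j≤n = begin
    gbin (suc n) (suc j) * den (suc j)             ≈⟨ gbin*den (suc n) (suc j) ⟩
    num (suc n) (suc j)                            ≈⟨ num-suc (suc n) j ⟩
    oneMinusQ^ (suc n) * num n j                   ≈⟨ *-comm _ _ ⟩
    num n j * oneMinusQ^ (suc n)                   ≈⟨ *-congˡ (oneMinusQ^≈ (suc n)) ⟩
    num n j * (1# - pow q (suc n))                 ≡⟨ ≡.cong (λ m → num n j * (1# - pow q (suc m))) (ℕP.m+[n∸m]≡n j≤n) ⟨
    num n j * (1# - pow q (suc j +ℕ (n ∸ j)))      ≈⟨ *-congˡ (+-congˡ (-‿cong (pow-+ q (suc j) (n ∸ j)))) ⟩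
    num n j * (1# - pow q (suc j) * pow q (n ∸ j)) ∎

  q-pascal₁ : ∀ {n j} → j ≤ n → gbin (suc n) (suc j) ≈ pow q (suc j) * gbin n (suc j) + gbin n j
  q-pascal₁ {n} {j} j≤n = *-cancelʳ-invertible (den-invertible (suc j)) (begin
    gbin (suc n) (suc j) * den (suc j)                                ≈⟨ gbin-suc-suc*den j≤n ⟩
    X * (1# - Q * R)                                                  ≈⟨ solve 3 (λ X Q R → X :* (con (+ 1) :- Q :* R) := Q :* (X :* (con (+ 1) :- R)) :+ X :* (con (+ 1) :- Q)) refl X Q R ⟩
    Q * (X * (1# - R)) + X * (1# - Q)                                 ≈⟨ +-cong (*-congˡ (gbin-suc*den n j)) (gbin*den-suc n j) ⟨
    Q * (gbin n (suc j) * den (suc j)) + gbin n j * den (suc j)       ≈⟨ +-congʳ (*-assoc Q _ _) ⟨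
    Q * gbin n (suc j) * den (suc j) + gbin n j * den (suc j)         ≈⟨ distribʳ _ _ _ ⟨
    (Q * gbin n (suc j) + gbin n j) * den (suc j)                     ∎)
    where
    X = num n j
    Q = pow q (suc j)
    R = pow q (n ∸ j)

  q-pascal₂ : ∀ {n j} → j ≤ n → gbin (suc n) (suc j) ≈ gbin n (suc j) + pow q (n ∸ j) * gbin n j
  q-pascal₂ {n} {j} j≤n = *-cancelʳ-invertible (den-invertible (suc j)) (begin
    gbin (suc n) (suc j) * den (suc j)                                ≈⟨ gbin-suc-suc*den j≤n ⟩
    X * (1# - Q * R)                                                  ≈⟨ solve 3 (λ X Q R → X :* (con (+ 1) :- Q :* R) := X :* (con (+ 1) :- R) :+ R :* (X :* (con (+ 1) :- Q))) refl X Q R ⟩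
    X * (1# - R) + R * (X * (1# - Q))                                 ≈⟨ +-cong (gbin-suc*den n j) (*-congˡ (gbin*den-suc n j)) ⟨
    gbin n (suc j) * den (suc j) + R * (gbin n j * den (suc j))       ≈⟨ +-congˡ (*-assoc R _ _) ⟨
    gbin n (suc j) * den (suc j) + R * gbin n j * den (suc j)         ≈⟨ distribʳ _ _ _ ⟨
    (gbin n (suc j) + R * gbin n j) * den (suc j)                     ∎)
    where
    X = num n j
    Q = pow q (suc j)
    R = pow q (n ∸ j)

  invQint*oneMinusQ^ : ∀ n → invQint n * oneMinusQ^ (suc n) ≈ oneMinusQ^ 1
  invQint*oneMinusQ^ n = inv-cancelʳ (oneMinusQ^ 1) (oneMinusX^ (suc n)) _

  gbin-absorption : ∀ n i → gbin (suc n) (suc i) * invQint n ≈ gbin n i * invQint i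
  gbin-absorption n i = *-cancelʳ-invertible (*-invertible (den-invertible (suc i)) (oneMinusQ^-invertible n)) (begin
    gbin (suc n) (suc i) * invQint n * (den (suc i) * O)          ≈⟨ solve 4 (λ G I D O → G :* I :* (D :* O) := (G :* D) :* (I :* O)) refl (gbin (suc n) (suc i)) (invQint n) (den (suc i)) O ⟩
    (gbin (suc n) (suc i) * den (suc i)) * (invQint n * O)        ≈⟨ *-cong (trans (gbin*den (suc n) (suc i)) (num-suc (suc n) i)) (invQint*oneMinusQ^ n) ⟩
    (O * num n i) * O₁                                            ≈⟨ solve 3 (λ O X O₁ → (O :* X) :* O₁ := (X :* O₁) :* O) refl O (num n i) O₁ ⟩
    (num n i * O₁) * O                                            ≈⟨ *-congʳ (*-cong (gbin*den n i) (invQint*oneMinusQ^ i)) ⟨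
    (gbin n i * den i) * (invQint i * oneMinusQ^ (suc i)) * O     ≈⟨ solve 5 (λ G D I Oi O → (G :* D) :* (I :* Oi) :* O := G :* I :* ((D :* Oi) :* O)) refl (gbin n i) (den i) (invQint i) (oneMinusQ^ (suc i)) O ⟩
    gbin n i * invQint i * ((den i * oneMinusQ^ (suc i)) * O)     ≈⟨ *-congˡ (*-congʳ (den-suc i)) ⟨
    gbin n i * invQint i * (den (suc i) * O)                      ∎)
    where
    O = oneMinusQ^ (suc n)
    O₁ = oneMinusQ^ 1

  sumTo-cong : ∀ n {f g : ℕ → Carrier} → (∀ j → j ≤ n → f j ≈ g j) → sumTo n f ≈ sumTo n g
  sumTo-cong zero    f≈g = f≈g 0 z≤n
  sumTo-cong (suc n) f≈g = +-cong (sumTo-cong n (λ j j≤n → f≈g j (ℕP.m≤n⇒m≤1+n j≤n))) (f≈g (suc n) ℕP.≤-refl)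

  sumTo-+ : ∀ n (f g : ℕ → Carrier) → sumTo n (λ j → f j + g j) ≈ sumTo n f + sumTo n g
  sumTo-+ zero    f g = refl
  sumTo-+ (suc n) f g = trans (+-congʳ (sumTo-+ n f g))
    (solve 4 (λ a b c d → (a :+ b) :+ (c :+ d) := (a :+ c) :+ (b :+ d)) refl (sumTo n f) (sumTo n g) (f (suc n)) (g (suc n)))

  sumTo-neg : ∀ n (f : ℕ → Carrier) → sumTo n (λ j → - f j) ≈ - sumTo n f
  sumTo-neg zero    f = refl
  sumTo-neg (suc n) f = trans (+-congʳ (sumTo-neg n f)) (-‿+-comm _ _)

  sumTo-sub : ∀ n (f g : ℕ → Carrier) → sumTo n (λ j → f j - g j) ≈ sumTo n f - sumTo n g
  sumTo-sub n f g = trans (sumTo-+ n f (λ j → - g j)) (+-congˡ (sumTo-neg n g))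

  sumTo-*ˡ : ∀ n x (f : ℕ → Carrier) → sumTo n (λ j → x * f j) ≈ x * sumTo n f
  sumTo-*ˡ zero    x f = refl
  sumTo-*ˡ (suc n) x f = trans (+-congʳ (sumTo-*ˡ n x f)) (sym (distribˡ _ _ _))

  sumTo-shift : ∀ n (f : ℕ → Carrier) → sumTo (suc n) f ≈ f 0 + sumTo n (λ j → f (suc j))
  sumTo-shift zero    f = refl
  sumTo-shift (suc n) f = trans (+-congʳ (sumTo-shift n f)) (+-assoc _ _ _)

  -- The boundary terms vanish because u 0 = 1 and [n, n+1] = 0.
  sumTo-gbin-suc : ∀ n (u v f : ℕ → Carrier) → u 0 ≈ 1# →
                   (∀ j → j ≤ n → gbin (suc n) (suc j) ≈ u (suc j) * gbin n (suc j) + v j * gbin n j) →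
                   sumTo (suc n) (λ j → gbin (suc n) j * f j) ≈ sumTo n (λ j → gbin n j * (u j * f j + v j * f (suc j)))
  sumTo-gbin-suc n u v f u0≈1 pascal = begin
    sumTo (suc n) (λ j → gbin (suc n) j * f j)                 ≈⟨ sumTo-shift n _ ⟩
    1# * f 0 + sumTo n (λ j → gbin (suc n) (suc j) * f (suc j)) ≈⟨ +-cong (*-congˡ (sym (*-identityˡ (f 0)))) (sumTo-cong n split) ⟩
    1# * (1# * f 0) + sumTo n (λ j → h (suc j) + w j)           ≈⟨ +-cong (*-congˡ (*-congʳ (sym u0≈1))) (sumTo-+ n _ w) ⟩
    h 0 + (sumTo n (λ j → h (suc j)) + sumTo n w)               ≈⟨ +-assoc _ _ _ ⟨
    (h 0 + sumTo n (λ j → h (suc j))) + sumTo n w               ≈⟨ +-congʳ (sumTo-shift n h) ⟨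
    (sumTo n h + h (suc n)) + sumTo n w                         ≈⟨ +-congʳ (+-congˡ h[n+1]≈0) ⟩
    (sumTo n h + 0#) + sumTo n w                                ≈⟨ +-congʳ (+-identityʳ _) ⟩
    sumTo n h + sumTo n w                                       ≈⟨ sumTo-+ n h w ⟨
    sumTo n (λ j → h j + w j)                                   ≈⟨ sumTo-cong n (λ j _ → distribˡ (gbin n j) _ _) ⟨
    sumTo n (λ j → gbin n j * (u j * f j + v j * f (suc j)))    ∎
    where
    h w : ℕ → Carrier
    h j = gbin n j * (u j * f j)
    w j = gbin n j * (v j * f (suc j))
    split : ∀ j → j ≤ n → gbin (suc n) (suc j) * f (suc j) ≈ h (suc j) + w j
    split j j≤n = trans (*-congʳ (pascal j j≤n))
      (solve 5 (λ U G V G′ F → (U :* G :+ V :* G′) :* F := G :* (U :* F) :+ G′ :* (V :* F)) refl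
        (u (suc j)) (gbin n (suc j)) (v j) (gbin n j) (f (suc j)))
    h[n+1]≈0 : h (suc n) ≈ 0#
    h[n+1]≈0 = trans (*-congʳ (gbin-vanishes n)) (zeroˡ _)

  sumTo-gbin-suc₁ : ∀ n (f : ℕ → Carrier) →
                    sumTo (suc n) (λ j → gbin (suc n) j * f j) ≈ sumTo n (λ j → gbin n j * (pow q j * f j + 1# * f (suc j)))
  sumTo-gbin-suc₁ n f = sumTo-gbin-suc n (pow q) (λ _ → 1#) f refl
    (λ j j≤n → trans (q-pascal₁ j≤n) (+-congˡ (sym (*-identityˡ _))))

  sumTo-gbin-suc₂ : ∀ n (f : ℕ → Carrier) →
                    sumTo (suc n) (λ j → gbin (suc n) j * f j) ≈ sumTo n (λ j → gbin n j * (1# * f j + pow q (n ∸ j) * f (suc j)))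
  sumTo-gbin-suc₂ n f = sumTo-gbin-suc n (λ _ → 1#) (λ j → pow q (n ∸ j)) f refl
    (λ j j≤n → trans (q-pascal₂ j≤n) (+-congʳ (sym (*-identityˡ _))))

  -- Integer powers of q and the iterated q-difference

  qpow-⊖ : ∀ m n → qpow (m ⊖ n) ≈ pow q m * pow q⁻¹ n
  qpow-⊖ m       zero    = sym (*-identityʳ _)
  qpow-⊖ zero    (suc n) = sym (*-identityˡ _)
  qpow-⊖ (suc m) (suc n) = begin
    qpow (suc m ⊖ suc n)                        ≡⟨ ≡.cong qpow (ℤP.[1+m]⊖[1+n]≡m⊖n m n) ⟩
    qpow (m ⊖ n)                                ≈⟨ qpow-⊖ m n ⟩
    pow q m * pow q⁻¹ n                         ≈⟨ *-identityˡ _ ⟨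
    1# * (pow q m * pow q⁻¹ n)                  ≈⟨ *-congʳ q*q⁻¹≈1# ⟨
    (q * q⁻¹) * (pow q m * pow q⁻¹ n)           ≈⟨ solve 4 (λ a b c d → (a :* b) :* (c :* d) := (a :* c) :* (b :* d)) refl q q⁻¹ (pow q m) (pow q⁻¹ n) ⟩
    (q * pow q m) * (q⁻¹ * pow q⁻¹ n)           ∎

  qpow-+ : ∀ x y → qpow (x +ℤ y) ≈ qpow x * qpow y
  qpow-+ (+ m)    (+ n)    = pow-+ q m n
  qpow-+ (+ m)    -[1+ n ] = qpow-⊖ m (suc n)
  qpow-+ -[1+ m ] (+ n)    = trans (qpow-⊖ n (suc m)) (*-comm _ _)
  qpow-+ -[1+ m ] -[1+ n ] = begin
    pow q⁻¹ (suc (suc (m +ℕ n)))      ≡⟨ ≡.cong (pow q⁻¹) (ℕP.+-suc (suc m) n) ⟨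
    pow q⁻¹ (suc m +ℕ suc n)          ≈⟨ pow-+ q⁻¹ (suc m) (suc n) ⟩
    pow q⁻¹ (suc m) * pow q⁻¹ (suc n) ∎

  pow*qpow : ∀ n x {y} → + n +ℤ x ≡ y → pow q n * qpow x ≈ qpow y
  pow*qpow n x n+x≡y = trans (sym (qpow-+ (+ n) x)) (reflexive (≡.cong qpow n+x≡y))

  qdiffExp : ℕ → ℕ → ℕ → ℤ
  qdiffExp l k j = + choose2 (+ (j +ℕ 1)) -ℤ + (l *ℕ (k +ℕ j))

  qdiff : (ℕ → Carrier) → ℕ → ℕ → Carrier
  qdiff e k l = sumTo l (λ j → gbin l j * sgn j * e (k +ℕ j) * qpow (qdiffExp l k j))

  qpow-qdiffExp-suc-l : ∀ l k j → pow q (k +ℕ j) * qpow (qdiffExp (suc l) k j) ≈ qpow (qdiffExp l k j)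
  qpow-qdiffExp-suc-l l k j = pow*qpow (k +ℕ j) (qdiffExp (suc l) k j)
    (exponent (+ (k +ℕ j)) (+ choose2ℕ (j +ℕ 1)) (+ (l *ℕ (k +ℕ j))))
    where
    exponent : ∀ m e x → m +ℤ (e -ℤ (m +ℤ x)) ≡ e -ℤ x
    exponent = solve-∀

  qpow-qdiffExp-suc-j : ∀ l k j → pow q k * qpow (qdiffExp (suc l) k (suc j)) ≈ qpow (qdiffExp l (suc k) j)
  qpow-qdiffExp-suc-j l k j = pow*qpow k (qdiffExp (suc l) k (suc j))
    (≡.trans (≡.cong (λ m → + k +ℤ (+ choose2ℕ (suc j +ℕ 1) -ℤ + (suc l *ℕ m))) (ℕP.+-suc k j))
             (exponent (+ k) (+ j) (+ choose2ℕ (j +ℕ 1)) (+ (l *ℕ suc (k +ℕ j)))))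
    where
    exponent : ∀ k j e x → k +ℤ ((e +ℤ (j +ℤ + 1)) -ℤ ((+ 1 +ℤ (k +ℤ j)) +ℤ x)) ≡ e -ℤ x
    exponent = solve-∀

  qpow-qdiffExp-suc-k : ∀ l k j → qpow (qdiffExp l (suc k) j) ≈ qpow (-ℤ + l) * qpow (qdiffExp l k j)
  qpow-qdiffExp-suc-k l k j = begin
    qpow (+ choose2ℕ (j +ℕ 1) -ℤ + (l *ℕ suc (k +ℕ j)))   ≡⟨ ≡.cong (λ m → qpow (+ choose2ℕ (j +ℕ 1) -ℤ + m)) (ℕP.*-suc l (k +ℕ j)) ⟩
    qpow (+ choose2ℕ (j +ℕ 1) -ℤ + (l +ℕ l *ℕ (k +ℕ j)))  ≡⟨ ≡.cong qpow (exponent (+ choose2ℕ (j +ℕ 1)) (+ l) (+ (l *ℕ (k +ℕ j)))) ⟩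
    qpow (-ℤ + l +ℤ qdiffExp l k j)                        ≈⟨ qpow-+ (-ℤ + l) (qdiffExp l k j) ⟩
    qpow (-ℤ + l) * qpow (qdiffExp l k j)                  ∎
    where
    exponent : ∀ e l x → e -ℤ (l +ℤ x) ≡ -ℤ l +ℤ (e -ℤ x)
    exponent = solve-∀

  qpow-qdiffExp-∸ : ∀ {l j} k → j ≤ l → pow q (l ∸ j) * qpow (qdiffExp l k (suc j)) ≈ pow q (suc l) * qpow (qdiffExp l (suc k) j)
  qpow-qdiffExp-∸ {l} {j} k j≤l = begin
    pow q (l ∸ j) * qpow (qdiffExp l k (suc j))                              ≈⟨ qpow-+ (+ (l ∸ j)) (qdiffExp l k (suc j)) ⟨
    qpow (+ (l ∸ j) +ℤ qdiffExp l k (suc j))                                 ≡⟨ ≡.cong (λ m → qpow (+ (l ∸ j) +ℤ (+ choose2ℕ (suc j +ℕ 1) -ℤ + (l *ℕ m)))) (ℕP.+-suc k j) ⟩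
    qpow (+ (l ∸ j) +ℤ (+ choose2ℕ (suc j +ℕ 1) -ℤ + (l *ℕ suc (k +ℕ j))))  ≡⟨ ≡.cong qpow (exponent (+ (l ∸ j)) (+ choose2ℕ (j +ℕ 1)) (+ j) (+ (l *ℕ suc (k +ℕ j)))) ⟩
    qpow (+ ((l ∸ j) +ℕ (j +ℕ 1)) +ℤ qdiffExp l (suc k) j)                   ≡⟨ ≡.cong (λ m → qpow (+ m +ℤ qdiffExp l (suc k) j)) l-j+j+1≡1+l ⟩
    qpow (+ suc l +ℤ qdiffExp l (suc k) j)                                   ≈⟨ qpow-+ (+ suc l) (qdiffExp l (suc k) j) ⟩
    pow q (suc l) * qpow (qdiffExp l (suc k) j)                              ∎
    where
    exponent : ∀ d e j x → d +ℤ ((e +ℤ (j +ℤ + 1)) -ℤ x) ≡ (d +ℤ (j +ℤ + 1)) +ℤ (e -ℤ x)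
    exponent = solve-∀
    l-j+j+1≡1+l : (l ∸ j) +ℕ (j +ℕ 1) ≡ suc l
    l-j+j+1≡1+l = ≡.trans (≡.sym (ℕP.+-assoc (l ∸ j) j 1)) (≡.trans (≡.cong (_+ℕ 1) (ℕP.m∸n+n≡m j≤l)) (ℕP.+-comm l 1))

  qdiff-suc : ∀ e k l → pow q k * qdiff e k (suc l) ≈ qdiff e k l - qdiff e (suc k) l
  qdiff-suc e k l = begin
    pow q k * qdiff e k (suc l)                                                  ≈⟨ *-congˡ (sumTo-cong (suc l) (λ j _ → *-assoc₃ _ _ _ _)) ⟩
    pow q k * sumTo (suc l) (λ j → gbin (suc l) j * t j)                         ≈⟨ *-congˡ (sumTo-gbin-suc₁ l t) ⟩
    pow q k * sumTo l (λ j → gbin l j * (pow q j * t j + 1# * t (suc j)))        ≈⟨ sumTo-*ˡ l (pow q k) _ ⟨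
    sumTo l (λ j → pow q k * (gbin l j * (pow q j * t j + 1# * t (suc j))))      ≈⟨ sumTo-cong l (λ j _ → split j) ⟩
    sumTo l (λ j → T k j - T (suc k) j)                                          ≈⟨ sumTo-sub l (T k) (T (suc k)) ⟩
    qdiff e k l - qdiff e (suc k) l                                              ∎
    where
    t : ℕ → Carrier
    t j = sgn j * e (k +ℕ j) * qpow (qdiffExp (suc l) k j)
    T : ℕ → ℕ → Carrier
    T k j = gbin l j * sgn j * e (k +ℕ j) * qpow (qdiffExp l k j)
    split : ∀ j → pow q k * (gbin l j * (pow q j * t j + 1# * t (suc j))) ≈ T k j - T (suc k) j
    split j = begin
      Qk * (G * (pow q j * (s * e (k +ℕ j) * P) + 1# * ((- 1# * s) * e (k +ℕ suc j) * P′)))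
        ≈⟨ solve 8 (λ Qk G Qj s a P a′ P′ → Qk :* (G :* (Qj :* (s :* a :* P) :+ con (+ 1) :* ((:- con (+ 1) :* s) :* a′ :* P′)))
                                          := G :* s :* a :* ((Qk :* Qj) :* P) :- G :* s :* a′ :* (Qk :* P′))
                   refl Qk G (pow q j) s (e (k +ℕ j)) P (e (k +ℕ suc j)) P′ ⟩
      G * s * e (k +ℕ j) * ((Qk * pow q j) * P) - G * s * e (k +ℕ suc j) * (Qk * P′)
        ≈⟨ +-cong (*-congˡ (trans (*-congʳ (sym (pow-+ q k j))) (qpow-qdiffExp-suc-l l k j)))
                  (-‿cong (*-cong (*-congˡ (reflexive (≡.cong e (ℕP.+-suc k j)))) (qpow-qdiffExp-suc-j l k j))) ⟩
      T k j - T (suc k) j ∎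
      where
      Qk = pow q k
      G = gbin l j
      s = sgn j
      P = qpow (qdiffExp (suc l) k j)
      P′ = qpow (qdiffExp (suc l) k (suc j))

  -- The second identity

  dual-cong : ∀ {a b : ℕ → Carrier} n → (∀ i → a i ≈ b i) → dual a n ≈ dual b n
  dual-cong n a≈b = sumTo-cong n (λ i _ → *-congʳ (*-congˡ (a≈b i)))

  dual-suc : ∀ b n → dual b (suc n) ≈ dual b n - pow q n * dual (λ i → b (suc i)) n
  dual-suc b n = begin
    dual b (suc n)                                                        ≈⟨ sumTo-cong (suc n) (λ i _ → *-assoc₃ _ _ _ _) ⟩
    sumTo (suc n) (λ i → gbin (suc n) i * f i)                             ≈⟨ sumTo-gbin-suc₂ n f ⟩
    sumTo n (λ i → gbin n i * (1# * f i + pow q (n ∸ i) * f (suc i)))      ≈⟨ sumTo-cong n split ⟩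
    sumTo n (λ i → T b i - pow q n * T (λ i → b (suc i)) i)                ≈⟨ sumTo-sub n _ _ ⟩
    dual b n - sumTo n (λ i → pow q n * T (λ i → b (suc i)) i)             ≈⟨ +-congˡ (-‿cong (sumTo-*ˡ n (pow q n) _)) ⟩
    dual b n - pow q n * dual (λ i → b (suc i)) n                          ∎
    where
    f : ℕ → Carrier
    f i = sgn i * b i * pow q (choose2ℕ i)
    T : (ℕ → Carrier) → ℕ → Carrier
    T b i = gbin n i * sgn i * b i * pow q (choose2ℕ i)
    q^[n-i]*q^i : ∀ {i} → i ≤ n → pow q (n ∸ i) * pow q i ≈ pow q n
    q^[n-i]*q^i {i} i≤n = trans (sym (pow-+ q (n ∸ i) i)) (reflexive (≡.cong (pow q) (ℕP.m∸n+n≡m i≤n)))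
    split : ∀ i → i ≤ n → gbin n i * (1# * f i + pow q (n ∸ i) * f (suc i)) ≈ T b i - pow q n * T (λ i → b (suc i)) i
    split i i≤n = begin
      G * (1# * (s * b i * C) + Q * ((- 1# * s) * b (suc i) * pow q (choose2ℕ i +ℕ i)))
        ≈⟨ *-congˡ (+-congˡ (*-congˡ (*-congˡ (pow-+ q (choose2ℕ i) i)))) ⟩
      G * (1# * (s * b i * C) + Q * ((- 1# * s) * b (suc i) * (C * pow q i)))
        ≈⟨ solve 7 (λ G s a C Q a′ Qi → G :* (con (+ 1) :* (s :* a :* C) :+ Q :* ((:- con (+ 1) :* s) :* a′ :* (C :* Qi)))
                                       := G :* s :* a :* C :- (Q :* Qi) :* (G :* s :* a′ :* C))
                   refl G s (b i) C Q (b (suc i)) (pow q i) ⟩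
      T b i - (Q * pow q i) * T (λ i → b (suc i)) i
        ≈⟨ +-congˡ (-‿cong (*-congʳ (q^[n-i]*q^i i≤n))) ⟩
      T b i - pow q n * T (λ i → b (suc i)) i ∎
      where
      G = gbin n i
      s = sgn i
      C = pow q (choose2ℕ i)
      Q = pow q (n ∸ i)

  qdiff-dual : ∀ l k a → qdiff (dual a) k l ≈ dual (λ i → a (l +ℕ i)) k
  qdiff-dual zero    k a = trans (solve 1 (λ x → con (+ 1) :* con (+ 1) :* x :* con (+ 1) := x) refl (dual a (k +ℕ 0)))
                                 (reflexive (≡.cong (dual a) (ℕP.+-identityʳ k)))
  qdiff-dual (suc l) k a = *-cancelʳ-invertible (pow-invertible q-invertible k) (begin
    qdiff (dual a) k (suc l) * pow q k                ≈⟨ *-comm _ _ ⟩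
    pow q k * qdiff (dual a) k (suc l)                ≈⟨ qdiff-suc (dual a) k l ⟩
    qdiff (dual a) k l - qdiff (dual a) (suc k) l     ≈⟨ +-cong (qdiff-dual l k a) (-‿cong (qdiff-dual l (suc k) a)) ⟩
    dual b k - dual b (suc k)                         ≈⟨ +-congˡ (-‿cong (dual-suc b k)) ⟩
    dual b k - (dual b k - pow q k * dual b′ k)       ≈⟨ solve 2 (λ x y → x :- (x :- y) := y) refl (dual b k) (pow q k * dual b′ k) ⟩
    pow q k * dual b′ k                               ≈⟨ *-comm _ _ ⟩
    dual b′ k * pow q k                               ≈⟨ *-congʳ (dual-cong k (λ i → reflexive (≡.cong a (ℕP.+-suc l i)))) ⟩
    dual (λ i → a (suc l +ℕ i)) k * pow q k           ∎)
    where
    b b′ : ℕ → Carrier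
    b i = a (l +ℕ i)
    b′ i = b (suc i)

  -- The third identity

  choose2ℕ-+1 : ∀ j → choose2ℕ (j +ℕ 1) ≡ choose2ℕ j +ℕ j
  choose2ℕ-+1 j = ≡.cong choose2ℕ (ℕP.+-comm j 1)

  choose2[j-1]+j : ∀ j → choose2 (+ j -ℤ + 1) +ℕ j ≡ suc (choose2ℕ j)
  choose2[j-1]+j zero    = ≡.refl
  choose2[j-1]+j (suc j) = ℕP.+-suc (choose2ℕ j) j

  [1-q]⁻¹ : Carrier
  [1-q]⁻¹ = inv (oneMinusX^ 1) (headOne-nz _ (headOne-omx 0))

  sumTo-gbin-suc-qdiff : ∀ e k l →
    sumTo (suc l) (λ j → gbin (suc l) j * (sgn j * e (k +ℕ j) * qpow (qdiffExp l k j)))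
      ≈ qdiff e k l - pow q (suc l) * qdiff e (suc k) l
  sumTo-gbin-suc-qdiff e k l = begin
    sumTo (suc l) (λ j → gbin (suc l) j * f j)                             ≈⟨ sumTo-gbin-suc₂ l f ⟩
    sumTo l (λ j → gbin l j * (1# * f j + pow q (l ∸ j) * f (suc j)))      ≈⟨ sumTo-cong l split ⟩
    sumTo l (λ j → T k j - pow q (suc l) * T (suc k) j)                    ≈⟨ sumTo-sub l _ _ ⟩
    qdiff e k l - sumTo l (λ j → pow q (suc l) * T (suc k) j)              ≈⟨ +-congˡ (-‿cong (sumTo-*ˡ l (pow q (suc l)) _)) ⟩
    qdiff e k l - pow q (suc l) * qdiff e (suc k) l                        ∎
    where
    f : ℕ → Carrier
    f j = sgn j * e (k +ℕ j) * qpow (qdiffExp l k j)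
    T : ℕ → ℕ → Carrier
    T k j = gbin l j * sgn j * e (k +ℕ j) * qpow (qdiffExp l k j)
    split : ∀ j → j ≤ l → gbin l j * (1# * f j + pow q (l ∸ j) * f (suc j)) ≈ T k j - pow q (suc l) * T (suc k) j
    split j j≤l = begin
      G * (1# * (s * e (k +ℕ j) * P) + Q * ((- 1# * s) * e (k +ℕ suc j) * P′))
        ≈⟨ solve 7 (λ G s a P Q a′ P′ → G :* (con (+ 1) :* (s :* a :* P) :+ Q :* ((:- con (+ 1) :* s) :* a′ :* P′))
                                       := G :* s :* a :* P :- G :* s :* a′ :* (Q :* P′))
                   refl G s (e (k +ℕ j)) P Q (e (k +ℕ suc j)) P′ ⟩
      T k j - G * s * e (k +ℕ suc j) * (Q * P′)
        ≈⟨ +-congˡ (-‿cong (*-cong (*-congˡ (reflexive (≡.cong e (ℕP.+-suc k j)))) (qpow-qdiffExp-∸ k j≤l))) ⟩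
      T k j - G * s * e (suc k +ℕ j) * (pow q (suc l) * qpow (qdiffExp l (suc k) j))
        ≈⟨ +-congˡ (-‿cong (solve 5 (λ G s a Q P → G :* s :* a :* (Q :* P) := Q :* (G :* s :* a :* P)) refl G s (e (suc k +ℕ j)) (pow q (suc l)) (qpow (qdiffExp l (suc k) j)))) ⟩
      T k j - pow q (suc l) * T (suc k) j ∎
      where
      G = gbin l j
      s = sgn j
      P = qpow (qdiffExp l k j)
      P′ = qpow (qdiffExp l k (suc j))
      Q = pow q (l ∸ j)

  sumTo-gbin-suc-dual : ∀ b k →
    sumTo (suc k) (λ j → gbin (suc k) j * (sgn j * b j * pow q (choose2 (+ j -ℤ + 1))))
      ≈ q * dual b k - dual (λ i → b (suc i)) k
  sumTo-gbin-suc-dual b k = begin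
    sumTo (suc k) (λ j → gbin (suc k) j * f j)                             ≈⟨ sumTo-gbin-suc₁ k f ⟩
    sumTo k (λ j → gbin k j * (pow q j * f j + 1# * f (suc j)))            ≈⟨ sumTo-cong k (λ j _ → split j) ⟩
    sumTo k (λ j → q * T b j - T (λ i → b (suc i)) j)                      ≈⟨ sumTo-sub k _ _ ⟩
    sumTo k (λ j → q * T b j) - dual (λ i → b (suc i)) k                   ≈⟨ +-congʳ (sumTo-*ˡ k q (T b)) ⟩
    q * dual b k - dual (λ i → b (suc i)) k                                ∎
    where
    f : ℕ → Carrier
    f j = sgn j * b j * pow q (choose2 (+ j -ℤ + 1))
    T : (ℕ → Carrier) → ℕ → Carrier
    T b j = gbin k j * sgn j * b j * pow q (choose2ℕ j)
    q^j : ∀ j → pow q j * pow q (choose2 (+ j -ℤ + 1)) ≈ q * pow q (choose2ℕ j)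
    q^j j = begin
      pow q j * pow q (choose2 (+ j -ℤ + 1)) ≈⟨ *-comm _ _ ⟩
      pow q (choose2 (+ j -ℤ + 1)) * pow q j ≈⟨ pow-+ q (choose2 (+ j -ℤ + 1)) j ⟨
      pow q (choose2 (+ j -ℤ + 1) +ℕ j)      ≡⟨ ≡.cong (pow q) (choose2[j-1]+j j) ⟩
      q * pow q (choose2ℕ j)                 ∎
    split : ∀ j → gbin k j * (pow q j * f j + 1# * f (suc j)) ≈ q * T b j - T (λ i → b (suc i)) j
    split j = begin
      G * (pow q j * (s * b j * P) + 1# * ((- 1# * s) * b (suc j) * C))
        ≈⟨ solve 7 (λ G Qj s a P a′ C → G :* (Qj :* (s :* a :* P) :+ con (+ 1) :* ((:- con (+ 1) :* s) :* a′ :* C))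
                                       := (Qj :* P) :* (G :* s :* a) :- G :* s :* a′ :* C)
                   refl G (pow q j) s (b j) P (b (suc j)) C ⟩
      (pow q j * P) * (G * s * b j) - G * s * b (suc j) * C
        ≈⟨ +-congʳ (*-congʳ (q^j j)) ⟩
      (q * C) * (G * s * b j) - G * s * b (suc j) * C
        ≈⟨ +-congʳ (solve 5 (λ q C G s a → (q :* C) :* (G :* s :* a) := q :* (G :* s :* a :* C)) refl q C G s (b j)) ⟩
      q * T b j - T (λ i → b (suc i)) j ∎
      where
      G = gbin k j
      s = sgn j
      P = pow q (choose2 (+ j -ℤ + 1))
      C = pow q (choose2ℕ j)

  identity₃-lhs-summand : ∀ a k l j →
    gbin (suc l) j * sgn (j +ℕ 1) * qint (k +ℕ j +ℕ 1) * dual a (k +ℕ j) * qpow (+ choose2 (+ j) -ℤ + (l *ℕ (k +ℕ j)) -ℤ + k)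
      ≈ [1-q]⁻¹ * (q * (gbin (suc l) j * (sgn j * dual a (k +ℕ j) * qpow (qdiffExp l k j)))
                   - gbin (suc l) j * sgn j * dual a (k +ℕ j) * qpow (qdiffExp (suc l) k j))
  identity₃-lhs-summand a k l j = begin
    G * sgn (j +ℕ 1) * (oneMinusQ^ (k +ℕ j +ℕ 1) * [1-q]⁻¹) * x * qpow (+ choose2ℕ j -ℤ + (l *ℕ (k +ℕ j)) -ℤ + k)
      ≈⟨ *-cong (*-congʳ (*-cong (*-congˡ (reflexive (≡.cong sgn (ℕP.+-comm j 1)))) (*-congʳ (oneMinusQ^≈ (k +ℕ j +ℕ 1))))) P₀≈P′ ⟩
    G * (- 1# * s) * ((1# - Qx) * [1-q]⁻¹) * x * P′
      ≈⟨ solve 6 (λ G s Qx ι x P′ → G :* (:- con (+ 1) :* s) :* ((con (+ 1) :- Qx) :* ι) :* x :* P′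
                                   := ι :* (G :* (s :* x :* (Qx :* P′)) :- G :* s :* x :* P′))
                 refl G s Qx [1-q]⁻¹ x P′ ⟩
    [1-q]⁻¹ * (G * (s * x * (Qx * P′)) - G * s * x * P′)
      ≈⟨ *-congˡ (+-congʳ (*-congˡ (*-congˡ Qx*P′≈q*P))) ⟩
    [1-q]⁻¹ * (G * (s * x * (q * P)) - G * s * x * P′)
      ≈⟨ *-congˡ (+-congʳ (solve 5 (λ G s x q P → G :* (s :* x :* (q :* P)) := q :* (G :* (s :* x :* P))) refl G s x q P)) ⟩
    [1-q]⁻¹ * (q * (G * (s * x * P)) - G * s * x * P′) ∎
    where
    G = gbin (suc l) j
    s = sgn j
    x = dual a (k +ℕ j)
    Qx = pow q (k +ℕ j +ℕ 1)
    P = qpow (qdiffExp l k j)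
    P′ = qpow (qdiffExp (suc l) k j)
    exponent : ∀ e j k x → (e -ℤ x) -ℤ k ≡ (e +ℤ j) -ℤ ((k +ℤ j) +ℤ x)
    exponent = solve-∀
    P₀≈P′ : qpow (+ choose2ℕ j -ℤ + (l *ℕ (k +ℕ j)) -ℤ + k) ≈ P′
    P₀≈P′ = reflexive (≡.cong qpow (≡.trans (exponent (+ choose2ℕ j) (+ j) (+ k) (+ (l *ℕ (k +ℕ j))))
                                      (≡.cong (λ m → + m -ℤ + (suc l *ℕ (k +ℕ j))) (≡.sym (choose2ℕ-+1 j)))))
    Qx*P′≈q*P : Qx * P′ ≈ q * P
    Qx*P′≈q*P = begin
      pow q (k +ℕ j +ℕ 1) * P′    ≡⟨ ≡.cong (λ m → pow q m * P′) (ℕP.+-comm (k +ℕ j) 1) ⟩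
      q * pow q (k +ℕ j) * P′     ≈⟨ *-assoc q _ _ ⟩
      q * (pow q (k +ℕ j) * P′)   ≈⟨ *-congˡ (qpow-qdiffExp-suc-l l k j) ⟩
      q * P                       ∎

  identity₃-lhs : ∀ a k l →
    sumTo (suc l) (λ j → gbin (suc l) j * sgn (j +ℕ 1) * qint (k +ℕ j +ℕ 1) * dual a (k +ℕ j)
                          * qpow (+ choose2 (+ j) -ℤ + (l *ℕ (k +ℕ j)) -ℤ + k))
      ≈ [1-q]⁻¹ * (q * (dual (λ i → a (l +ℕ i)) k - pow q (suc l) * dual (λ i → a (l +ℕ i)) (suc k))
                   - dual (λ i → a (suc l +ℕ i)) k)
  identity₃-lhs a k l = begin
    sumTo (suc l) (λ j → Term j)                                                         ≈⟨ sumTo-cong (suc l) (λ j _ → identity₃-lhs-summand a k l j) ⟩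
    sumTo (suc l) (λ j → [1-q]⁻¹ * (q * (gbin (suc l) j * f j) - T j))                   ≈⟨ sumTo-*ˡ (suc l) [1-q]⁻¹ _ ⟩
    [1-q]⁻¹ * sumTo (suc l) (λ j → q * (gbin (suc l) j * f j) - T j)                     ≈⟨ *-congˡ (sumTo-sub (suc l) _ T) ⟩
    [1-q]⁻¹ * (sumTo (suc l) (λ j → q * (gbin (suc l) j * f j)) - qdiff (dual a) k (suc l))
      ≈⟨ *-congˡ (+-cong (trans (sumTo-*ˡ (suc l) q _) (*-congˡ (sumTo-gbin-suc-qdiff (dual a) k l))) (-‿cong (qdiff-dual (suc l) k a))) ⟩
    [1-q]⁻¹ * (q * (qdiff (dual a) k l - pow q (suc l) * qdiff (dual a) (suc k) l) - dual (λ i → a (suc l +ℕ i)) k)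
      ≈⟨ *-congˡ (+-congʳ (*-congˡ (+-cong (qdiff-dual l k a) (-‿cong (*-congˡ (qdiff-dual l (suc k) a)))))) ⟩
    [1-q]⁻¹ * (q * (dual (λ i → a (l +ℕ i)) k - pow q (suc l) * dual (λ i → a (l +ℕ i)) (suc k)) - dual (λ i → a (suc l +ℕ i)) k) ∎
    where
    Term f T : ℕ → Carrier
    Term j = gbin (suc l) j * sgn (j +ℕ 1) * qint (k +ℕ j +ℕ 1) * dual a (k +ℕ j) * qpow (+ choose2 (+ j) -ℤ + (l *ℕ (k +ℕ j)) -ℤ + k)
    f j = sgn j * dual a (k +ℕ j) * qpow (qdiffExp l k j)
    T j = gbin (suc l) j * sgn j * dual a (k +ℕ j) * qpow (qdiffExp (suc l) k j)

  identity₃-rhs-summand : ∀ (a : ℕ → Carrier) k l j →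
    gbin (suc k) j * sgn j * qint (l +ℕ j +ℕ 1) * a (l +ℕ j) * qpow (+ choose2 (+ j -ℤ + 1))
      ≈ [1-q]⁻¹ * (gbin (suc k) j * (sgn j * a (l +ℕ j) * pow q (choose2 (+ j -ℤ + 1)))
                   - pow q (suc (suc l)) * (gbin (suc k) j * sgn j * a (l +ℕ j) * pow q (choose2ℕ j)))
  identity₃-rhs-summand a k l j = begin
    G * s * (oneMinusQ^ (l +ℕ j +ℕ 1) * [1-q]⁻¹) * x * P
      ≈⟨ *-congʳ (*-congʳ (*-congˡ (*-congʳ (oneMinusQ^≈ (l +ℕ j +ℕ 1))))) ⟩
    G * s * ((1# - Qx) * [1-q]⁻¹) * x * P
      ≈⟨ solve 6 (λ G s Qx ι x P → G :* s :* ((con (+ 1) :- Qx) :* ι) :* x :* P := ι :* (G :* (s :* x :* P) :- (Qx :* P) :* (G :* s :* x)))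
                 refl G s Qx [1-q]⁻¹ x P ⟩
    [1-q]⁻¹ * (G * (s * x * P) - (Qx * P) * (G * s * x))
      ≈⟨ *-congˡ (+-congˡ (-‿cong (*-congʳ Qx*P≈Q*C))) ⟩
    [1-q]⁻¹ * (G * (s * x * P) - (Q * C) * (G * s * x))
      ≈⟨ *-congˡ (+-congˡ (-‿cong (solve 5 (λ Q C G s x → (Q :* C) :* (G :* s :* x) := Q :* (G :* s :* x :* C)) refl Q C G s x))) ⟩
    [1-q]⁻¹ * (G * (s * x * P) - Q * (G * s * x * C)) ∎
    where
    G = gbin (suc k) j
    s = sgn j
    x = a (l +ℕ j)
    m = choose2 (+ j -ℤ + 1)
    P = pow q m
    C = pow q (choose2ℕ j)
    Q = pow q (suc (suc l))
    Qx = pow q (l +ℕ j +ℕ 1)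
    exponent : ∀ l j m → l +ℕ j +ℕ 1 +ℕ m ≡ l +ℕ 1 +ℕ (m +ℕ j)
    exponent = solve-∀ℕ
    exponent′ : ∀ l c → l +ℕ 1 +ℕ suc c ≡ suc (suc l) +ℕ c
    exponent′ = solve-∀ℕ
    Qx*P≈Q*C : Qx * P ≈ Q * C
    Qx*P≈Q*C = begin
      pow q (l +ℕ j +ℕ 1) * pow q m        ≈⟨ pow-+ q (l +ℕ j +ℕ 1) m ⟨
      pow q (l +ℕ j +ℕ 1 +ℕ m)             ≡⟨ ≡.cong (pow q) (≡.trans (exponent l j m) (≡.cong (l +ℕ 1 +ℕ_) (choose2[j-1]+j j))) ⟩
      pow q (l +ℕ 1 +ℕ suc (choose2ℕ j))   ≡⟨ ≡.cong (pow q) (exponent′ l (choose2ℕ j)) ⟩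
      pow q (suc (suc l) +ℕ choose2ℕ j)    ≈⟨ pow-+ q (suc (suc l)) (choose2ℕ j) ⟩
      Q * C                                ∎

  identity₃-rhs : ∀ a k l →
    sumTo (suc k) (λ j → gbin (suc k) j * sgn j * qint (l +ℕ j +ℕ 1) * a (l +ℕ j) * qpow (+ choose2 (+ j -ℤ + 1)))
      ≈ [1-q]⁻¹ * (q * (dual (λ i → a (l +ℕ i)) k - pow q (suc l) * dual (λ i → a (l +ℕ i)) (suc k))
                   - dual (λ i → a (suc l +ℕ i)) k)
  identity₃-rhs a k l = begin
    sumTo (suc k) (λ j → Term j)                                                ≈⟨ sumTo-cong (suc k) (λ j _ → identity₃-rhs-summand a k l j) ⟩
    sumTo (suc k) (λ j → [1-q]⁻¹ * (gbin (suc k) j * f j - Q * T j))            ≈⟨ sumTo-*ˡ (suc k) [1-q]⁻¹ _ ⟩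
    [1-q]⁻¹ * sumTo (suc k) (λ j → gbin (suc k) j * f j - Q * T j)              ≈⟨ *-congˡ (sumTo-sub (suc k) _ _) ⟩
    [1-q]⁻¹ * (sumTo (suc k) (λ j → gbin (suc k) j * f j) - sumTo (suc k) (λ j → Q * T j))
      ≈⟨ *-congˡ (+-cong (sumTo-gbin-suc-dual b k) (-‿cong (sumTo-*ˡ (suc k) Q T))) ⟩
    [1-q]⁻¹ * ((q * dual b k - dual (λ i → b (suc i)) k) - Q * dual b (suc k))
      ≈⟨ *-congˡ (solve 5 (λ q x y Q z → (q :* x :- y) :- (q :* Q) :* z := q :* (x :- Q :* z) :- y) refl q (dual b k) (dual (λ i → b (suc i)) k) (pow q (suc l)) (dual b (suc k))) ⟩
    [1-q]⁻¹ * (q * (dual b k - pow q (suc l) * dual b (suc k)) - dual (λ i → b (suc i)) k)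
      ≈⟨ *-congˡ (+-congˡ (-‿cong (dual-cong k (λ i → reflexive (≡.cong a (ℕP.+-suc l i)))))) ⟩
    [1-q]⁻¹ * (q * (dual b k - pow q (suc l) * dual b (suc k)) - dual (λ i → a (suc l +ℕ i)) k) ∎
    where
    b : ℕ → Carrier
    b i = a (l +ℕ i)
    Q = pow q (suc (suc l))
    Term f T : ℕ → Carrier
    Term j = gbin (suc k) j * sgn j * qint (l +ℕ j +ℕ 1) * a (l +ℕ j) * qpow (+ choose2 (+ j -ℤ + 1))
    f j = sgn j * b j * pow q (choose2 (+ j -ℤ + 1))
    T j = gbin (suc k) j * sgn j * b j * pow q (choose2ℕ j)

  identity₃ : ∀ a k l →
    sumTo (l +ℕ 1) (λ j → gbin (l +ℕ 1) j * sgn (j +ℕ 1) * qint (k +ℕ j +ℕ 1) * dual a (k +ℕ j)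
                          * qpow (+ choose2 (+ j) -ℤ + (l *ℕ (k +ℕ j)) -ℤ + k))
      ≈ sumTo (k +ℕ 1) (λ j → gbin (k +ℕ 1) j * sgn j * qint (l +ℕ j +ℕ 1) * a (l +ℕ j)
                          * qpow (+ choose2 (+ j -ℤ + 1)))
  identity₃ a k l rewrite ℕP.+-comm l 1 | ℕP.+-comm k 1 = trans (identity₃-lhs a k l) (sym (identity₃-rhs a k l))

  -- The first identity

  invGbin*num : ∀ k l → invGbin k l * num (k +ℕ l) k ≈ den k
  invGbin*num zero    l = trans (*-identityˡ _) (trans (num-zero l) (sym (num-zero 0)))
  invGbin*num (suc k) l = inv-cancelʳ (den (suc k)) (numP (suc k +ℕ l) (suc k)) _

  invGbin-zero : ∀ k → invGbin k 0 ≈ 1#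
  invGbin-zero k = *-cancelʳ-invertible (den-invertible k) (begin
    invGbin k 0 * den k              ≈⟨ *-congˡ (num-self k) ⟨
    invGbin k 0 * num k k            ≡⟨ ≡.cong (λ m → invGbin k 0 * num m k) (ℕP.+-identityʳ k) ⟨
    invGbin k 0 * num (k +ℕ 0) k     ≈⟨ invGbin*num k 0 ⟩
    den k                            ≈⟨ *-identityˡ (den k) ⟨
    1# * den k                       ∎)

  -- The q-analogue of the Beta value B(k+1, l+1) = k! l! / (k+l+1)!.
  qBeta : ℕ → ℕ → Carrier
  qBeta k l = invQint (k +ℕ l) * invGbin k l

  qBeta*num : ∀ k l → qBeta k l * num (suc (k +ℕ l)) (suc k) ≈ oneMinusQ^ 1 * den k
  qBeta*num k l = begin
    invQint n * invGbin k l * num (suc n) (suc k)                  ≈⟨ *-congˡ (num-suc (suc n) k) ⟩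
    invQint n * invGbin k l * (oneMinusQ^ (suc n) * num n k)       ≈⟨ solve 4 (λ I G O N → I :* G :* (O :* N) := (I :* O) :* (G :* N)) refl (invQint n) (invGbin k l) (oneMinusQ^ (suc n)) (num n k) ⟩
    (invQint n * oneMinusQ^ (suc n)) * (invGbin k l * num n k)     ≈⟨ *-cong (invQint*oneMinusQ^ n) (invGbin*num k l) ⟩
    oneMinusQ^ 1 * den k                                           ∎
    where
    n = k +ℕ l

  -- After multiplying by M, each of the three qBeta values is (1 - q) den k times one factor 1 - q^m.
  qBeta-suc : ∀ k l → pow q (suc k) * qBeta k (suc l) ≈ qBeta k l - qBeta (suc k) l
  qBeta-suc k l = *-cancelʳ-invertible (num-invertible (suc (suc k)) l) (begin
    pow q (suc k) * qBeta k (suc l) * M                        ≈⟨ *-assoc _ _ _ ⟩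
    pow q (suc k) * (qBeta k (suc l) * M)                      ≈⟨ *-congˡ β[k,l+1]*M ⟩
    pow q (suc k) * (o₁D * oneMinusQ^ (suc l))                 ≈⟨ *-congˡ (*-congˡ (oneMinusQ^≈ (suc l))) ⟩
    pow q (suc k) * (o₁D * (1# - pow q (suc l)))               ≈⟨ solve 3 (λ Q x R → Q :* (x :* (con (+ 1) :- R)) := x :* (con (+ 1) :- Q :* R) :- x :* (con (+ 1) :- Q)) refl (pow q (suc k)) o₁D (pow q (suc l)) ⟩
    o₁D * (1# - pow q (suc k) * pow q (suc l)) - o₁D * (1# - pow q (suc k))
      ≈⟨ +-cong (*-congˡ (+-congˡ (-‿cong q^[k+l+2]))) (-‿cong (*-congˡ (sym (oneMinusQ^≈ (suc k))))) ⟩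
    o₁D * (1# - pow q (suc (suc n))) - o₁D * oneMinusQ^ (suc k) ≈⟨ +-cong (*-congˡ (oneMinusQ^≈ (suc (suc n)))) (-‿cong (sym (*-assoc _ _ _))) ⟨
    o₁D * oneMinusQ^ (suc (suc n)) - oneMinusQ^ 1 * (den k * oneMinusQ^ (suc k))
      ≈⟨ +-cong β[k,l]*M (-‿cong (trans (qBeta*num (suc k) l) (*-congˡ (den-suc k)))) ⟨
    qBeta k l * M - qBeta (suc k) l * M                        ≈⟨ [y-z]x≈yx-zx M _ _ ⟨
    (qBeta k l - qBeta (suc k) l) * M                          ∎)
    where
    n = k +ℕ l
    M = num (suc (suc n)) (suc (suc k))
    o₁D = oneMinusQ^ 1 * den k
    q^[k+l+2] : pow q (suc k) * pow q (suc l) ≈ pow q (suc (suc n))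
    q^[k+l+2] = trans (sym (pow-+ q (suc k) (suc l))) (reflexive (≡.cong (λ m → pow q (suc m)) (ℕP.+-suc k l)))
    β[k,l]*M : qBeta k l * M ≈ o₁D * oneMinusQ^ (suc (suc n))
    β[k,l]*M = begin
      qBeta k l * M                                              ≈⟨ *-congˡ (num-suc (suc (suc n)) (suc k)) ⟩
      qBeta k l * (oneMinusQ^ (suc (suc n)) * num (suc n) (suc k)) ≈⟨ solve 3 (λ β O N → β :* (O :* N) := (β :* N) :* O) refl (qBeta k l) _ _ ⟩
      qBeta k l * num (suc n) (suc k) * oneMinusQ^ (suc (suc n))   ≈⟨ *-congʳ (qBeta*num k l) ⟩
      o₁D * oneMinusQ^ (suc (suc n))                               ∎
    1+n-k≡1+l : suc n ∸ k ≡ suc l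
    1+n-k≡1+l = ≡.trans (≡.cong (_∸ k) (≡.sym (ℕP.+-suc k l))) (ℕP.m+n∸m≡n k (suc l))
    β[k,l+1]*M : qBeta k (suc l) * M ≈ o₁D * oneMinusQ^ (suc l)
    β[k,l+1]*M = begin
      qBeta k (suc l) * M                                                  ≈⟨ *-congˡ (num-sucʳ (suc (suc n)) (suc k)) ⟩
      qBeta k (suc l) * (num (suc (suc n)) (suc k) * oneMinusQ^ (suc n ∸ k)) ≈⟨ *-assoc _ _ _ ⟨
      qBeta k (suc l) * num (suc (suc n)) (suc k) * oneMinusQ^ (suc n ∸ k)   ≡⟨ ≡.cong (λ m → qBeta k (suc l) * num (suc (suc n)) (suc k) * oneMinusQ^ m) 1+n-k≡1+l ⟩
      qBeta k (suc l) * num (suc (suc n)) (suc k) * oneMinusQ^ (suc l)       ≡⟨ ≡.cong (λ m → qBeta k (suc l) * num (suc m) (suc k) * oneMinusQ^ (suc l)) (ℕP.+-suc k l) ⟨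
      qBeta k (suc l) * num (suc (k +ℕ suc l)) (suc k) * oneMinusQ^ (suc l) ≈⟨ *-congʳ (qBeta*num k (suc l)) ⟩
      o₁D * oneMinusQ^ (suc l)                                              ∎

  -- m ↦ 1/[m]_q; the junk value at m = 0 is never used.
  recipQint : ℕ → Carrier
  recipQint m = invQint (m ∸ 1)

  qdiff-recipQint : ∀ l k → qdiff recipQint (suc k) l ≈ qBeta k l
  qdiff-recipQint zero    k = begin
    1# * 1# * invQint (k +ℕ 0) * 1#  ≈⟨ solve 1 (λ x → con (+ 1) :* con (+ 1) :* x :* con (+ 1) := x :* con (+ 1)) refl (invQint (k +ℕ 0)) ⟩
    invQint (k +ℕ 0) * 1#            ≈⟨ *-congˡ (invGbin-zero k) ⟨
    qBeta k 0                        ∎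
  qdiff-recipQint (suc l) k = *-cancelʳ-invertible (pow-invertible q-invertible (suc k)) (begin
    qdiff recipQint (suc k) (suc l) * pow q (suc k)                      ≈⟨ *-comm _ _ ⟩
    pow q (suc k) * qdiff recipQint (suc k) (suc l)                      ≈⟨ qdiff-suc recipQint (suc k) l ⟩
    qdiff recipQint (suc k) l - qdiff recipQint (suc (suc k)) l          ≈⟨ +-cong (qdiff-recipQint l k) (-‿cong (qdiff-recipQint l (suc k))) ⟩
    qBeta k l - qBeta (suc k) l                                          ≈⟨ qBeta-suc k l ⟨
    pow q (suc k) * qBeta k (suc l)                                      ≈⟨ *-comm _ _ ⟩
    qBeta k (suc l) * pow q (suc k)                                      ∎)

  dividedShift : (ℕ → Carrier) → ℕ → Carrier
  dividedShift a i = pow q i * a (suc i) * invQint i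

  dual-suc*invQint : ∀ a n → dual a (suc n) * invQint n ≈ a 0 * invQint n - dual (dividedShift a) n
  dual-suc*invQint a n = begin
    dual a (suc n) * invQint n                                   ≈⟨ *-congʳ (sumTo-shift n T) ⟩
    (T 0 + sumTo n (λ i → T (suc i))) * invQint n                 ≈⟨ distribʳ _ _ _ ⟩
    T 0 * invQint n + sumTo n (λ i → T (suc i)) * invQint n       ≈⟨ +-cong (*-congʳ (solve 1 (λ x → con (+ 1) :* con (+ 1) :* x :* con (+ 1) := x) refl (a 0)))
                                                                            (trans (*-comm _ _) (sym (sumTo-*ˡ n _ _))) ⟩
    a 0 * invQint n + sumTo n (λ i → invQint n * T (suc i))       ≈⟨ +-congˡ (sumTo-cong n (λ i _ → split i)) ⟩
    a 0 * invQint n + sumTo n (λ i → - T′ i)                      ≈⟨ +-congˡ (sumTo-neg n T′) ⟩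
    a 0 * invQint n - dual (dividedShift a) n                     ∎
    where
    T T′ : ℕ → Carrier
    T i = gbin (suc n) i * sgn i * a i * pow q (choose2ℕ i)
    T′ i = gbin n i * sgn i * dividedShift a i * pow q (choose2ℕ i)
    split : ∀ i → invQint n * T (suc i) ≈ - T′ i
    split i = begin
      invQint n * (gbin (suc n) (suc i) * (- 1# * s) * a (suc i) * pow q (choose2ℕ i +ℕ i))
        ≈⟨ *-congˡ (*-congˡ (pow-+ q (choose2ℕ i) i)) ⟩
      invQint n * (gbin (suc n) (suc i) * (- 1# * s) * a (suc i) * (C * pow q i))
        ≈⟨ solve 6 (λ I G s x C Q → I :* (G :* (:- con (+ 1) :* s) :* x :* (C :* Q)) := :- ((G :* I) :* (s :* x :* C :* Q)))
                   refl (invQint n) (gbin (suc n) (suc i)) s (a (suc i)) C (pow q i) ⟩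
      - ((gbin (suc n) (suc i) * invQint n) * (s * a (suc i) * C * pow q i))
        ≈⟨ -‿cong (*-congʳ (gbin-absorption n i)) ⟩
      - ((gbin n i * invQint i) * (s * a (suc i) * C * pow q i))
        ≈⟨ -‿cong (solve 6 (λ G I s x C Q → (G :* I) :* (s :* x :* C :* Q) := G :* s :* (Q :* x :* I) :* C) refl (gbin n i) (invQint i) s (a (suc i)) C (pow q i)) ⟩
      - T′ i ∎
      where
      s = sgn i
      C = pow q (choose2ℕ i)

  identity₁-first-summand : ∀ a k l j →
    gbin l j * sgn j * dual a (k +ℕ j +ℕ 1) * invQint (k +ℕ j) * qpow (+ choose2 (+ (j +ℕ 1)) -ℤ + (l *ℕ (k +ℕ j +ℕ 1)))
      ≈ a 0 * (gbin l j * sgn j * recipQint (suc k +ℕ j) * qpow (qdiffExp l (suc k) j))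
        - qpow (-ℤ + l) * (gbin l j * sgn j * dual (dividedShift a) (k +ℕ j) * qpow (qdiffExp l k j))
  identity₁-first-summand a k l j = begin
    G * s * dual a (k +ℕ j +ℕ 1) * I * qpow (+ choose2ℕ (j +ℕ 1) -ℤ + (l *ℕ (k +ℕ j +ℕ 1)))
      ≡⟨ ≡.cong (λ m → G * s * dual a m * I * qpow (+ choose2ℕ (j +ℕ 1) -ℤ + (l *ℕ m))) (ℕP.+-comm (k +ℕ j) 1) ⟩
    G * s * dual a (suc (k +ℕ j)) * I * P
      ≈⟨ solve 5 (λ G s x I P → G :* s :* x :* I :* P := G :* s :* (x :* I) :* P) refl G s (dual a (suc (k +ℕ j))) I P ⟩
    G * s * (dual a (suc (k +ℕ j)) * I) * P
      ≈⟨ *-congʳ (*-congˡ (dual-suc*invQint a (k +ℕ j))) ⟩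
    G * s * (a 0 * I - x) * P
      ≈⟨ *-congˡ (qpow-qdiffExp-suc-k l k j) ⟩
    G * s * (a 0 * I - x) * (q⁻ˡ * P′)
      ≈⟨ solve 7 (λ G s a₀ I x q⁻ˡ P′ → G :* s :* (a₀ :* I :- x) :* (q⁻ˡ :* P′) := a₀ :* (G :* s :* I :* (q⁻ˡ :* P′)) :- q⁻ˡ :* (G :* s :* x :* P′))
                 refl G s (a 0) I x q⁻ˡ P′ ⟩
    a 0 * (G * s * I * (q⁻ˡ * P′)) - q⁻ˡ * (G * s * x * P′)
      ≈⟨ +-congʳ (*-congˡ (*-congˡ (qpow-qdiffExp-suc-k l k j))) ⟨
    a 0 * (G * s * I * P) - q⁻ˡ * (G * s * x * P′) ∎
    where
    G = gbin l j
    s = sgn j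
    I = invQint (k +ℕ j)
    x = dual (dividedShift a) (k +ℕ j)
    q⁻ˡ = qpow (-ℤ + l)
    P = qpow (qdiffExp l (suc k) j)
    P′ = qpow (qdiffExp l k j)

  identity₁-first : ∀ a k l →
    sumTo l (λ j → gbin l j * sgn j * dual a (k +ℕ j +ℕ 1) * invQint (k +ℕ j) * qpow (+ choose2 (+ (j +ℕ 1)) -ℤ + (l *ℕ (k +ℕ j +ℕ 1))))
      ≈ a 0 * qBeta k l - qpow (-ℤ + l) * dual (λ i → dividedShift a (l +ℕ i)) k
  identity₁-first a k l = begin
    sumTo l (λ j → Term j)                                                     ≈⟨ sumTo-cong l (λ j _ → identity₁-first-summand a k l j) ⟩
    sumTo l (λ j → a 0 * H j - q⁻ˡ * F j)                                      ≈⟨ sumTo-sub l _ _ ⟩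
    sumTo l (λ j → a 0 * H j) - sumTo l (λ j → q⁻ˡ * F j)                      ≈⟨ +-cong (sumTo-*ˡ l (a 0) H) (-‿cong (sumTo-*ˡ l q⁻ˡ F)) ⟩
    a 0 * qdiff recipQint (suc k) l - q⁻ˡ * qdiff (dual (dividedShift a)) k l ≈⟨ +-cong (*-congˡ (qdiff-recipQint l k)) (-‿cong (*-congˡ (qdiff-dual l k (dividedShift a)))) ⟩
    a 0 * qBeta k l - q⁻ˡ * dual (λ i → dividedShift a (l +ℕ i)) k           ∎
    where
    q⁻ˡ = qpow (-ℤ + l)
    Term H F : ℕ → Carrier
    Term j = gbin l j * sgn j * dual a (k +ℕ j +ℕ 1) * invQint (k +ℕ j) * qpow (+ choose2 (+ (j +ℕ 1)) -ℤ + (l *ℕ (k +ℕ j +ℕ 1)))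
    H j = gbin l j * sgn j * recipQint (suc k +ℕ j) * qpow (qdiffExp l (suc k) j)
    F j = gbin l j * sgn j * dual (dividedShift a) (k +ℕ j) * qpow (qdiffExp l k j)

  identity₁-second : ∀ (a : ℕ → Carrier) k l →
    sumTo k (λ j → gbin k j * sgn j * a (l +ℕ j +ℕ 1) * invQint (l +ℕ j) * qpow (+ choose2 (+ (j +ℕ 1))))
      ≈ qpow (-ℤ + l) * dual (λ i → dividedShift a (l +ℕ i)) k
  identity₁-second a k l = trans (sumTo-cong k (λ j _ → summand j)) (sumTo-*ˡ k q⁻ˡ _)
    where
    q⁻ˡ = qpow (-ℤ + l)
    exponent : ∀ l j → -ℤ l +ℤ (l +ℤ j) ≡ j
    exponent = solve-∀
    q^j : ∀ j → pow q j ≈ q⁻ˡ * pow q (l +ℕ j)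
    q^j j = sym (trans (sym (qpow-+ (-ℤ + l) (+ (l +ℕ j)))) (reflexive (≡.cong qpow (exponent (+ l) (+ j)))))
    summand : ∀ j → gbin k j * sgn j * a (l +ℕ j +ℕ 1) * invQint (l +ℕ j) * pow q (choose2ℕ (j +ℕ 1))
                    ≈ q⁻ˡ * (gbin k j * sgn j * dividedShift a (l +ℕ j) * pow q (choose2ℕ j))
    summand j = begin
      G * s * a (l +ℕ j +ℕ 1) * I * pow q (choose2ℕ (j +ℕ 1))
        ≡⟨ ≡.cong₂ (λ m n → G * s * a m * I * pow q n) (ℕP.+-comm (l +ℕ j) 1) (choose2ℕ-+1 j) ⟩
      G * s * a (suc (l +ℕ j)) * I * pow q (choose2ℕ j +ℕ j)
        ≈⟨ *-congˡ (trans (pow-+ q (choose2ℕ j) j) (*-congˡ (q^j j))) ⟩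
      G * s * a (suc (l +ℕ j)) * I * (pow q (choose2ℕ j) * (q⁻ˡ * pow q (l +ℕ j)))
        ≈⟨ solve 7 (λ G s x I C Q R → G :* s :* x :* I :* (C :* (Q :* R)) := Q :* (G :* s :* (R :* x :* I) :* C))
                   refl G s (a (suc (l +ℕ j))) I (pow q (choose2ℕ j)) q⁻ˡ (pow q (l +ℕ j)) ⟩
      q⁻ˡ * (G * s * dividedShift a (l +ℕ j) * pow q (choose2ℕ j)) ∎
      where
      G = gbin k j
      s = sgn j
      I = invQint (l +ℕ j)

  identity₁ : ∀ a k l →
    sumTo l (λ j → gbin l j * sgn j * dual a (k +ℕ j +ℕ 1) * invQint (k +ℕ j)
                    * qpow (+ choose2 (+ (j +ℕ 1)) -ℤ + (l *ℕ (k +ℕ j +ℕ 1))))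
      + sumTo k (λ j → gbin k j * sgn j * a (l +ℕ j +ℕ 1) * invQint (l +ℕ j) * qpow (+ choose2 (+ (j +ℕ 1))))
      ≈ a 0 * invQint (k +ℕ l) * invGbin k l
  identity₁ a k l = begin
    _                                       ≈⟨ +-cong (identity₁-first a k l) (identity₁-second a k l) ⟩
    (a 0 * qBeta k l - q⁻ˡ * X) + q⁻ˡ * X   ≈⟨ solve 3 (λ x y z → (x :- y :* z) :+ y :* z := x) refl (a 0 * qBeta k l) q⁻ˡ X ⟩
    a 0 * qBeta k l                         ≈⟨ *-assoc _ _ _ ⟨
    a 0 * invQint (k +ℕ l) * invGbin k l    ∎
    where
    q⁻ˡ = qpow (-ℤ + l)
    X = dual (λ i → dividedShift a (l +ℕ i)) k

theorem1 : ∀ {c ℓ} (A : QqAlgebra c ℓ) → let open Ops A in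
           (a : ℕ → Carrier) (k l : ℕ) →
           ((sumTo l (λ j → gbin l j * sgn j * dual a (k +ℕ j +ℕ 1) * invQint (k +ℕ j)
                        * qpow (+ choose2 (+ (j +ℕ 1)) -ℤ + (l *ℕ (k +ℕ j +ℕ 1))))
             + sumTo k (λ j → gbin k j * sgn j * a (l +ℕ j +ℕ 1) * invQint (l +ℕ j)
                        * qpow (+ choose2 (+ (j +ℕ 1)))))
             ≈ (a 0 * invQint (k +ℕ l) * invGbin k l))
           × (sumTo l (λ j → gbin l j * sgn j * dual a (k +ℕ j)
                        * qpow (+ choose2 (+ (j +ℕ 1)) -ℤ + (l *ℕ (k +ℕ j))))
             ≈ sumTo k (λ j → gbin k j * sgn j * a (l +ℕ j) * qpow (+ choose2 (+ j))))
           × (sumTo (l +ℕ 1) (λ j → gbin (l +ℕ 1) j * sgn (j +ℕ 1) * qint (k +ℕ j +ℕ 1) * dual a (k +ℕ j)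
                        * qpow (+ choose2 (+ j) -ℤ + (l *ℕ (k +ℕ j)) -ℤ + k))
             ≈ sumTo (k +ℕ 1) (λ j → gbin (k +ℕ 1) j * sgn j * qint (l +ℕ j +ℕ 1) * a (l +ℕ j)
                        * qpow (+ choose2 (+ j -ℤ + 1))))
theorem1 A a k l = identity₁ a k l , qdiff-dual l k a , identity₃ a k l
  where open QIdentities A
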